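{- For every integer $s\ge 0$, the number of magic squares of order $3$ with magic number $3s$ equals \[ 2s^2-\frac{20}{3}s+1-(-1)^s+\frac{8}{3}\,(s \bmod 3), \] and the associated generating function is \[ \sum_{s\ge 0}(\text{number of magic squares of order 3 with magic number } 3s)\,t^s=\frac{8t^4(1+2t)}{(1-t)(1-t^2)(1-t^3)}=8\left(t^4+3t^5+4t^6+7t^7+10t^8+13t^9+17t^{10}+22t^{11}+26t^{12}+\cdots\right). \]
   Context: A magic square of order $3$ is a $3\times 3$ matrix with pairwise distinct nonnegative integer entries such that all three row sums, all three column sums, and the two diagonal sums are equal to the same number $m$ (the magic number). Here magic squares are counted as matrices (rotations and reflections of a square are counted as different squares). $s \bmod 3$ denotes the remainder of $s$ upon division by $3$, in $\{0,1,2\}$. -}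

module Defs where

open import Data.Nat as ℕ using (ℕ; zero; suc; _≤_)
open import Data.Nat.DivMod using (_%_)
open import Data.Fin using (Fin; zero; suc; combine)
open import Data.Fin.Properties using (all?) renaming (_≟_ to _≟ᶠ_)
open import Data.Vec using (Vec; []; _∷_; lookup)
open import Data.List as List using (List; []; _∷_; upTo; concatMap; filter; length)
open import Data.Integer as ℤ using (ℤ; +_)
open import Data.Rational as ℚ using (ℚ; 1ℚ; _/_)
open import Data.Product using (_×_)
open import Relation.Binary.PropositionalEquality using (_≡_)
open import Relation.Nullary using (Dec)
open import Relation.Nullary.Decidable using (_×-dec_; _→-dec_)

Square : Set
Square = Fin 3 → Fin 3 → ℕ

rowSum : Square → Fin 3 → ℕ
rowSum M i = M i zero ℕ.+ M i (suc zero) ℕ.+ M i (suc (suc zero))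

colSum : Square → Fin 3 → ℕ
colSum M j = M zero j ℕ.+ M (suc zero) j ℕ.+ M (suc (suc zero)) j

diagSum : Square → ℕ
diagSum M = M zero zero ℕ.+ M (suc zero) (suc zero) ℕ.+ M (suc (suc zero)) (suc (suc zero))

antiDiagSum : Square → ℕ
antiDiagSum M = M zero (suc (suc zero)) ℕ.+ M (suc zero) (suc zero) ℕ.+ M (suc (suc zero)) zero

Distinct : Square → Set
Distinct M = ∀ i j k l → M i j ≡ M k l → (i ≡ k × j ≡ l)

IsMagic : ℕ → Square → Set
IsMagic m M =
  Distinct M × (∀ i → rowSum M i ≡ m) × (∀ j → colSum M j ≡ m)
  × diagSum M ≡ m × antiDiagSum M ≡ m

isMagic? : ∀ m M → Dec (IsMagic m M)
isMagic? m M =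
  all? (λ i → all? (λ j → all? (λ k → all? (λ l →
      (M i j ℕ.≟ M k l) →-dec ((i ≟ᶠ k) ×-dec (j ≟ᶠ l))))))
  ×-dec all? (λ i → rowSum M i ℕ.≟ m)
  ×-dec all? (λ j → colSum M j ℕ.≟ m)
  ×-dec (diagSum M ℕ.≟ m)
  ×-dec (antiDiagSum M ℕ.≟ m)

-- In a magic square with magic number m every entry is ≤ m
-- (entries are nonnegative and each row sums to m), so the magic squares
-- with magic number m are exactly those, among all matrices with entries
-- in {0,…,b} with b = m, that satisfy IsMagic m.

tuples : ℕ → (n : ℕ) → List (Vec ℕ n)
tuples b zero    = [] ∷ []
tuples b (suc n) = concatMap (λ x → List.map (x ∷_) (tuples b n)) (upTo (suc b))

toSquare : Vec ℕ 9 → Square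
toSquare v i j = lookup v (combine i j)

boundedSquares : ℕ → List Square
boundedSquares b = List.map toSquare (tuples b 9)

magicCount : ℕ → ℕ
magicCount m = length (filter (isMagic? m) (boundedSquares m))

negOnePow : ℕ → ℚ
negOnePow zero    = 1ℚ
negOnePow (suc n) = ℚ.- negOnePow n

nℚ : ℕ → ℚ
nℚ n = + n / 1

formula : ℕ → ℚ
formula s =
  ((((+ 2 / 1) ℚ.* nℚ s ℚ.* nℚ s) ℚ.- ((+ 20 / 3) ℚ.* nℚ s)) ℚ.+ 1ℚ)
  ℚ.- negOnePow s ℚ.+ ((+ 8 / 3) ℚ.* nℚ (s % 3))

Series : Set
Series = ℕ → ℤ

poly : List ℤ → Series
poly []       n       = + 0
poly (c ∷ cs) zero    = c
poly (c ∷ cs) (suc n) = poly cs n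

sumTo : (ℕ → ℤ) → ℕ → ℤ
sumTo f zero    = f zero
sumTo f (suc n) = sumTo f n ℤ.+ f (suc n)

_⊛_ : Series → Series → Series
(f ⊛ g) n = sumTo (λ k → f k ℤ.* g (n ℕ.∸ k)) n
infixl 7 _⊛_

denominator : Series
denominator = poly (+ 1 ∷ ℤ.- + 1 ∷ [])
            ⊛ poly (+ 1 ∷ + 0 ∷ ℤ.- + 1 ∷ [])
            ⊛ poly (+ 1 ∷ + 0 ∷ + 0 ∷ ℤ.- + 1 ∷ [])

numerator : Series
numerator = poly (+ 0 ∷ + 0 ∷ + 0 ∷ + 0 ∷ + 8 ∷ + 16 ∷ [])

magicGF : Series
magicGF s = + magicCount (3 ℕ.* s)

{-# OPTIONS --safe #-}
-- A magic square with magic number 3s has centre s and is determined by its first two entries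
-- x and y: with U = x − s and V = 2s − x − y every entry is s + pU + qV for small integers p, q
-- (Lucas).  The entries are pairwise distinct iff U ≠ 0 and 2V ≠ βU for β ∈ {0, ±1, ±2, ±4}.
-- For x = s + a with 1 ≤ a ≤ s and r = s − a, the entries are nonnegative for exactly 2r + 1
-- values of y, of which 1 + 2[a ≤ r] + 2[2a ≤ r] + 2[a even, a/2 ≤ r] lie on one of the seven
-- lines 2V = βU; a half turn of the square gives the same count for x = s − a, and x = s
-- contributes nothing.  Summing over a gives 2s² − 2s − 4⌊s/2⌋ − 8⌊s/3⌋ squares; the three claims
-- are direct calculations from this.
module Submission where

module Sums where

  open import Data.Nat using (ℕ; zero; suc; _+_; _*_; _∸_; _≤_; _<_)
  open import Data.Nat.Properties
  import Data.Nat.Tactic.RingSolver as ℕ-Solver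
  open import Data.Nat.ListAction using (sum)
  open import Data.List using (List; []; _∷_; map)
  open import Data.List.Relation.Unary.All as All using (All; []; _∷_)
  open import Data.List.Relation.Unary.AllPairs using (AllPairs; []; _∷_)
  open import Data.Product using (_×_; _,_)
  open import Data.Empty using (⊥-elim)
  open import Function using (_⇔_; mk⇔; Equivalence)
  open import Relation.Nullary using (Dec; yes; no; ¬_; ¬?)
  open import Relation.Unary using (Pred; Decidable)
  open import Relation.Binary.PropositionalEquality

  ∑ : ℕ → (ℕ → ℕ) → ℕ
  ∑ zero    f = 0
  ∑ (suc n) f = ∑ n f + f n

  syntax ∑ n (λ i → e) = ∑[ i < n ] e

  module _ {f g : ℕ → ℕ} where

    ∑-cong : ∀ n → (∀ i → i < n → f i ≡ g i) → ∑ n f ≡ ∑ n g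
    ∑-cong zero    eq = refl
    ∑-cong (suc n) eq = cong₂ _+_ (∑-cong n (λ i i<n → eq i (m<n⇒m<1+n i<n))) (eq n ≤-refl)

    ∑-distrib-+ : ∀ n → ∑[ i < n ] (f i + g i) ≡ ∑ n f + ∑ n g
    ∑-distrib-+ zero    = refl
    ∑-distrib-+ (suc n) rewrite ∑-distrib-+ n = swap (∑ n f) (∑ n g) (f n) (g n)
      where
      swap : ∀ a b c d → a + b + (c + d) ≡ a + c + (b + d)
      swap = ℕ-Solver.solve-∀

  ∑-zero : ∀ {f} n → (∀ i → i < n → f i ≡ 0) → ∑ n f ≡ 0
  ∑-zero zero    eq = refl
  ∑-zero (suc n) eq rewrite ∑-zero n (λ i i<n → eq i (m<n⇒m<1+n i<n)) = eq n ≤-refl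

  ∑-const : ∀ c n → ∑[ _ < n ] c ≡ n * c
  ∑-const c zero    = refl
  ∑-const c (suc n) rewrite ∑-const c n = +-comm (n * c) c

  ∑-split : ∀ f m n → ∑ (m + n) f ≡ ∑ m f + ∑[ i < n ] f (m + i)
  ∑-split f m zero    rewrite +-identityʳ m = sym (+-identityʳ _)
  ∑-split f m (suc n) rewrite +-suc m n | ∑-split f m n = +-assoc (∑ m f) _ _

  ∑-reverse : ∀ f n → ∑ n f ≡ ∑[ i < n ] f (n ∸ suc i)
  ∑-reverse f zero    = refl
  ∑-reverse f (suc n) = begin
    ∑ n f + f n                       ≡⟨ +-comm (∑ n f) (f n) ⟩
    f n + ∑ n f                       ≡⟨ cong (f n +_) (∑-reverse f n) ⟩
    f n + ∑[ i < n ] f (n ∸ suc i)    ≡⟨ ∑-split (λ i → f (suc n ∸ suc i)) 1 n ⟨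
    ∑[ i < suc n ] f (suc n ∸ suc i)  ∎
    where open ≡-Reasoning

  ∑-pairs : ∀ f n → ∑ (n + n) f ≡ ∑[ j < n ] (f (j + j) + f (suc (j + j)))
  ∑-pairs f zero    = refl
  ∑-pairs f (suc n) rewrite +-suc n n | ∑-pairs f n = +-assoc _ (f (n + n)) (f (suc (n + n)))

  ∑-odd : ∀ n → ∑[ i < n ] suc (2 * i) ≡ n * n
  ∑-odd zero    = refl
  ∑-odd (suc n) rewrite ∑-odd n = step n
    where
    step : ∀ n → n * n + suc (2 * n) ≡ suc n * suc n
    step = ℕ-Solver.solve-∀

  module _ {a} {A : Set a} where

    ∑-sum-comm : ∀ (f : ℕ → A → ℕ) n xs →
                 ∑[ i < n ] sum (map (f i) xs) ≡ sum (map (λ x → ∑[ i < n ] f i x) xs)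
    ∑-sum-comm f n []       = trans (∑-const 0 n) (*-zeroʳ n)
    ∑-sum-comm f n (x ∷ xs) = trans (∑-distrib-+ n) (cong (∑[ i < n ] f i x +_) (∑-sum-comm f n xs))

  indicator : ∀ {p} {P : Set p} → Dec P → ℕ
  indicator (yes _) = 1
  indicator (no _)  = 0

  module _ {p} {P : Set p} where

    indicator-yes : (P? : Dec P) → P → indicator P? ≡ 1
    indicator-yes (yes _)  _  = refl
    indicator-yes (no ¬p)  p  = ⊥-elim (¬p p)

    indicator-no : (P? : Dec P) → ¬ P → indicator P? ≡ 0
    indicator-no (yes p) ¬p = ⊥-elim (¬p p)
    indicator-no (no _)  _  = refl

    indicator-cong : ∀ {q} {Q : Set q} (P? : Dec P) (Q? : Dec Q) → P ⇔ Q → indicator P? ≡ indicator Q?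
    indicator-cong P? (yes q) P⇔Q = indicator-yes P? (Equivalence.from P⇔Q q)
    indicator-cong P? (no ¬q) P⇔Q = indicator-no P? (λ p → ¬q (Equivalence.to P⇔Q p))

  ∑-indicator-cong : ∀ {p q} {P : Pred ℕ p} {Q : Pred ℕ q} (P? : Decidable P) (Q? : Decidable Q) n →
                     (∀ i → i < n → P i ⇔ Q i) → ∑[ i < n ] indicator (P? i) ≡ ∑[ i < n ] indicator (Q? i)
  ∑-indicator-cong P? Q? n P⇔Q = ∑-cong n λ i i<n → indicator-cong (P? i) (Q? i) (P⇔Q i i<n)

  module _ {p} {P : Pred ℕ p} (P? : Decidable P) where

    ∑-indicator-none : ∀ n → (∀ i → i < n → ¬ P i) → ∑[ i < n ] indicator (P? i) ≡ 0
    ∑-indicator-none n ¬P = ∑-zero n (λ i i<n → indicator-no (P? i) (¬P i i<n))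

    ∑-indicator-prefix : ∀ m n → m ≤ n → (∀ i → i < n → P i → i < m) → (∀ i → i < m → P i) →
                         ∑[ i < n ] indicator (P? i) ≡ m
    ∑-indicator-prefix m n m≤n only all = begin
      ∑ n f                                    ≡⟨ cong (λ k → ∑ k f) (m+[n∸m]≡n m≤n) ⟨
      ∑ (m + (n ∸ m)) f                        ≡⟨ ∑-split f m (n ∸ m) ⟩
      ∑ m f + ∑[ i < n ∸ m ] f (m + i)         ≡⟨ cong₂ _+_ prefix suffix ⟩
      m * 1 + 0                                ≡⟨ trans (+-identityʳ _) (*-identityʳ m) ⟩
      m                                        ∎
      where
      open ≡-Reasoning
      f = λ i → indicator (P? i)
      prefix : ∑ m f ≡ m * 1
      prefix = trans (∑-cong m (λ i i<m → indicator-yes (P? i) (all i i<m))) (∑-const 1 m)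
      suffix : ∑[ i < n ∸ m ] f (m + i) ≡ 0
      suffix = ∑-zero (n ∸ m) λ i i<n∸m → indicator-no (P? (m + i)) λ Pm+i →
        m+n≮m m i (only (m + i) (subst (m + i <_) (m+[n∸m]≡n m≤n) (+-monoʳ-< m i<n∸m)) Pm+i)

    ∑-indicator-single : ∀ t n → t < n → (∀ i → P i → i ≡ t) → P t → ∑[ i < n ] indicator (P? i) ≡ 1
    ∑-indicator-single t n t<n only Pt = begin
      ∑ n f                                    ≡⟨ cong (λ k → ∑ k f) (m+[n∸m]≡n t<n) ⟨
      ∑ (suc t + (n ∸ suc t)) f                ≡⟨ ∑-split f (suc t) (n ∸ suc t) ⟩
      ∑ t f + f t + ∑[ i < n ∸ suc t ] f (suc t + i)
                                               ≡⟨ cong₂ (λ a b → a + f t + b) below above ⟩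
      0 + f t + 0                              ≡⟨ +-identityʳ (f t) ⟩
      f t                                      ≡⟨ indicator-yes (P? t) Pt ⟩
      1                                        ∎
      where
      open ≡-Reasoning
      f = λ i → indicator (P? i)
      below : ∑ t f ≡ 0
      below = ∑-indicator-none t (λ i i<t Pi → <-irrefl (only i Pi) i<t)
      above : ∑[ i < n ∸ suc t ] f (suc t + i) ≡ 0
      above = ∑-zero (n ∸ suc t) λ i _ → indicator-no (P? (suc t + i)) λ Pi →
        m+1+n≢m t (trans (+-suc t i) (only _ Pi))

  module _ {a p} {A : Set a} {P : Pred A p} (P? : Decidable P) where

    exclusive-none+count≡1 : ∀ xs → AllPairs (λ x y → ¬ (P x × P y)) xs →
                  indicator (All.all? (λ x → ¬? (P? x)) xs) + sum (map (λ x → indicator (P? x)) xs) ≡ 1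
    exclusive-none+count≡1 []       []             = refl
    exclusive-none+count≡1 (x ∷ xs) (excl ∷ excls) = by-cases (P? x)
      where
      all¬? : ∀ ys → Dec (All (λ y → ¬ P y) ys)
      all¬? ys = All.all? (λ y → ¬? (P? y)) ys
      occurrences : List A → ℕ
      occurrences ys = sum (map (λ y → indicator (P? y)) ys)
      others-absent : ∀ {ys} → P x → All (λ y → ¬ (P x × P y)) ys → occurrences ys ≡ 0
      others-absent Px []              = refl
      others-absent Px (¬PxPy ∷ excl′) =
        cong₂ _+_ (indicator-no (P? _) (λ Py → ¬PxPy (Px , Py))) (others-absent Px excl′)
      by-cases : Dec (P x) → indicator (all¬? (x ∷ xs)) + (indicator (P? x) + occurrences xs) ≡ 1
      by-cases (yes Px) = cong₂ _+_ (indicator-no (all¬? (x ∷ xs)) (λ ¬Ps → All.head ¬Ps Px))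
                                    (cong₂ _+_ (indicator-yes (P? x) Px) (others-absent Px excl))
      by-cases (no ¬Px) = trans (cong₂ _+_ (indicator-cong (all¬? (x ∷ xs)) (all¬? xs) (mk⇔ All.tail (¬Px ∷_)))
                                           (cong (_+ occurrences xs) (indicator-no (P? x) ¬Px)))
                                (exclusive-none+count≡1 xs excls)

module Counting where

  open import Data.Nat using (ℕ; zero; suc; _+_; _≤_; s≤s; _≟_)
  open import Data.List using (List; []; _∷_; _++_; length; filter; map; concatMap; applyUpTo)
  open import Data.List.Properties using (length-++; filter-++; filter-none)
  open import Data.List.Relation.Unary.All as All using ()
  open import Data.Vec using (Vec; []; _∷_)
  open import Data.Vec.Properties using (∷-injectiveˡ; ∷-injectiveʳ)
  open import Data.Vec.Relation.Unary.All using ([]; _∷_) renaming (All to AllV)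
  open import Data.Product using (_×_; proj₁; proj₂)
  open import Relation.Nullary using (Dec; yes; no; ¬_)
  open import Relation.Unary using (Pred; Decidable)
  open import Relation.Binary.PropositionalEquality
  open import Defs
  open Sums

  module _ {a p} {A : Set a} {P : Pred A p} (P? : Decidable P) where

    count : List A → ℕ
    count xs = length (filter P? xs)

    count-∷ : ∀ x xs → count (x ∷ xs) ≡ indicator (P? x) + count xs
    count-∷ x xs with P? x
    ... | yes _ = refl
    ... | no _  = refl

    count-++ : ∀ xs ys → count (xs ++ ys) ≡ count xs + count ys
    count-++ xs ys = trans (cong length (filter-++ P? xs ys)) (length-++ (filter P? xs) {filter P? ys})

    count-none : ∀ xs → (∀ x → ¬ P x) → count xs ≡ 0
    count-none xs ¬P = cong length (filter-none P? {xs} (All.tabulate (λ {x} _ → ¬P x)))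

  module _ {a b p} {A : Set a} {B : Set b} {P : Pred B p} (P? : Decidable P) where

    count-map : (f : A → B) → ∀ xs → count P? (map f xs) ≡ count (λ x → P? (f x)) xs
    count-map f []       = refl
    count-map f (x ∷ xs) rewrite count-∷ P? (f x) (map f xs) | count-∷ (λ x → P? (f x)) x xs
      | count-map f xs = refl

    count-concatMap : (G : ℕ → List B) → ∀ n (f : ℕ → ℕ) →
                      count P? (concatMap G (applyUpTo f n)) ≡ ∑[ i < n ] count P? (G (f i))
    count-concatMap G zero    f = refl
    count-concatMap G (suc n) f
      rewrite count-++ P? (G (f 0)) (concatMap G (applyUpTo (λ i → f (suc i)) n))
            | count-concatMap G n (λ i → f (suc i))
      = sym (∑-split (λ i → count P? (G (f i))) 1 n)

  count-tuples-suc : ∀ {p} b n {P : Pred (Vec ℕ (suc n)) p} (P? : Decidable P) →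
    count P? (tuples b (suc n)) ≡ ∑[ x < suc b ] count (λ v → P? (x ∷ v)) (tuples b n)
  count-tuples-suc b n P? =
    trans (count-concatMap {A = ℕ} P? (λ x → map (x ∷_) (tuples b n)) (suc b) (λ i → i))
          (∑-cong (suc b) (λ x _ → count-map P? (x ∷_) (tuples b n)))

  count-tuples-unique : ∀ b n (w : Vec ℕ n) → AllV (_≤ b) w → ∀ {p} {P : Pred (Vec ℕ n) p} (P? : Decidable P) →
                        (∀ v → P v → v ≡ w) → P w → count P? (tuples b n) ≡ 1
  count-tuples-unique b zero    []       []            P? only Pw =
    trans (count-∷ P? [] []) (cong (_+ 0) (indicator-yes (P? []) Pw))
  count-tuples-unique b (suc n) (w ∷ ws) (w≤b ∷ ws≤b) P? only Pw = begin
    count P? (tuples b (suc n))                           ≡⟨ count-tuples-suc b n P? ⟩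
    ∑[ x < suc b ] count (λ v → P? (x ∷ v)) (tuples b n)  ≡⟨ ∑-cong (suc b) (λ x _ → slice x) ⟩
    ∑[ x < suc b ] indicator (x ≟ w)                      ≡⟨ ∑-indicator-single (_≟ w) w (suc b) (s≤s w≤b) (λ _ eq → eq) refl ⟩
    1                                                     ∎
    where
    open ≡-Reasoning
    slice : ∀ x → count (λ v → P? (x ∷ v)) (tuples b n) ≡ indicator (x ≟ w)
    slice x with x ≟ w
    ... | yes refl = count-tuples-unique b n ws ws≤b (λ v → P? (x ∷ v)) (λ v Pxv → ∷-injectiveʳ (only _ Pxv)) Pw
    ... | no x≢w   = count-none (λ v → P? (x ∷ v)) (tuples b n) (λ v Pxv → x≢w (∷-injectiveˡ (only _ Pxv)))

  count-tuples-indicator : ∀ b n (w : Vec ℕ n) {c} {C : Set c} (C? : Dec C) {p} {P : Pred (Vec ℕ n) p} (P? : Decidable P) →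
                           (∀ v → P v → v ≡ w × C) → (C → P w) → (C → AllV (_≤ b) w) →
                           count P? (tuples b n) ≡ indicator C?
  count-tuples-indicator b n w (yes c) P? only C⇒Pw C⇒bounded =
    count-tuples-unique b n w (C⇒bounded c) P? (λ v Pv → proj₁ (only v Pv)) (C⇒Pw c)
  count-tuples-indicator b n w (no ¬c) P? only _ _ = count-none P? (tuples b n) (λ v Pv → ¬c (proj₂ (only v Pv)))

  magicCount-∑ : ∀ m → magicCount m ≡
    ∑[ x < suc m ] ∑[ y < suc m ] count (λ v → isMagic? m (toSquare (x ∷ y ∷ v))) (tuples m 7)
  magicCount-∑ m = begin
    magicCount m
      ≡⟨ count-map (isMagic? m) toSquare (tuples m 9) ⟩
    count (λ v → isMagic? m (toSquare v)) (tuples m 9)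
      ≡⟨ count-tuples-suc m 8 (λ v → isMagic? m (toSquare v)) ⟩
    ∑[ x < suc m ] count (λ v → isMagic? m (toSquare (x ∷ v))) (tuples m 8)
      ≡⟨ ∑-cong (suc m) (λ x _ → count-tuples-suc m 7 (λ v → isMagic? m (toSquare (x ∷ v)))) ⟩
    ∑[ x < suc m ] ∑[ y < suc m ] count (λ v → isMagic? m (toSquare (x ∷ y ∷ v))) (tuples m 7) ∎
    where open ≡-Reasoning

module Parametrisation where

  open import Data.Nat as ℕ using (ℕ)
  import Data.Nat.Properties as ℕ
  import Data.Nat.Tactic.RingSolver as ℕ-Solver
  open import Data.Integer using (ℤ; +_; 0ℤ; _+_; _-_; _*_; -_)
  import Data.Integer.Properties as ℤ
  import Data.Integer.Tactic.RingSolver as ℤ-Solver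
  open import Data.Fin using (Fin; zero; suc; #_)
  open import Data.Vec using (Vec; []; _∷_; lookup)
  open import Data.Product using (_×_; _,_)
  open import Relation.Binary.PropositionalEquality
  open import Defs

  -- Lucas' parametrisation: a magic square with magic number 3S has centre S and entries
  -- S + P i j * U + Q i j * V, where U = M₀₀ − S and V = 2S − M₀₀ − M₀₁.

  fromRows : ∀ {A : Set} → Vec (Vec A 3) 3 → Fin 3 → Fin 3 → A
  fromRows rows i j = lookup (lookup rows i) j

  P Q : Fin 3 → Fin 3 → ℤ
  P = fromRows ((  + 1 ∷ - + 1 ∷   + 0 ∷ []) ∷
                (- + 1 ∷   + 0 ∷   + 1 ∷ []) ∷
                (  + 0 ∷   + 1 ∷ - + 1 ∷ []) ∷ [])
  Q = fromRows ((  + 0 ∷ - + 1 ∷   + 1 ∷ []) ∷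
                (  + 1 ∷   + 0 ∷ - + 1 ∷ []) ∷
                (- + 1 ∷   + 1 ∷   + 0 ∷ []) ∷ [])

  offset : ℤ → ℤ → Fin 3 → Fin 3 → ℤ
  offset U V i j = P i j * U + Q i j * V

  lucas : ℤ → ℤ → ℤ → Fin 3 → Fin 3 → ℤ
  lucas S U V i j = S + offset U V i j

  paramU : ℕ → ℕ → ℤ
  paramU s x = + x - + s

  paramV : ℕ → ℕ → ℕ → ℤ
  paramV s x y = + 2 * + s - + x - + y

  Represents : ℤ → ℤ → ℤ → Square → Set
  Represents S U V M = ∀ i j → + M i j ≡ lucas S U V i j

  LineSums : ℕ → Square → Set
  LineSums m M = (∀ i → rowSum M i ≡ m) × (∀ j → colSum M j ≡ m) × diagSum M ≡ m × antiDiagSum M ≡ m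

  offset-line : ∀ i₁ j₁ i₂ j₂ i₃ j₃ → P i₁ j₁ + P i₂ j₂ + P i₃ j₃ ≡ 0ℤ → Q i₁ j₁ + Q i₂ j₂ + Q i₃ j₃ ≡ 0ℤ →
                ∀ U V → offset U V i₁ j₁ + offset U V i₂ j₂ + offset U V i₃ j₃ ≡ 0ℤ
  offset-line i₁ j₁ i₂ j₂ i₃ j₃ ΣP≡0 ΣQ≡0 U V = begin
    offset U V i₁ j₁ + offset U V i₂ j₂ + offset U V i₃ j₃
      ≡⟨ collect (P i₁ j₁) (P i₂ j₂) (P i₃ j₃) (Q i₁ j₁) (Q i₂ j₂) (Q i₃ j₃) U V ⟩
    (P i₁ j₁ + P i₂ j₂ + P i₃ j₃) * U + (Q i₁ j₁ + Q i₂ j₂ + Q i₃ j₃) * V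
      ≡⟨ cong₂ (λ p q → p * U + q * V) ΣP≡0 ΣQ≡0 ⟩
    0ℤ * U + 0ℤ * V
      ≡⟨ cong₂ _+_ (ℤ.*-zeroˡ U) (ℤ.*-zeroˡ V) ⟩
    0ℤ ∎
    where
    open ≡-Reasoning
    collect : ∀ p₁ p₂ p₃ q₁ q₂ q₃ U V → (p₁ * U + q₁ * V) + (p₂ * U + q₂ * V) + (p₃ * U + q₃ * V)
                                        ≡ (p₁ + p₂ + p₃) * U + (q₁ + q₂ + q₃) * V
    collect = ℤ-Solver.solve-∀

  offset-rowSum : ∀ U V i → offset U V i (# 0) + offset U V i (# 1) + offset U V i (# 2) ≡ 0ℤ
  offset-rowSum U V zero             = offset-line (# 0) (# 0) (# 0) (# 1) (# 0) (# 2) refl refl U V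
  offset-rowSum U V (suc zero)       = offset-line (# 1) (# 0) (# 1) (# 1) (# 1) (# 2) refl refl U V
  offset-rowSum U V (suc (suc zero)) = offset-line (# 2) (# 0) (# 2) (# 1) (# 2) (# 2) refl refl U V

  offset-colSum : ∀ U V j → offset U V (# 0) j + offset U V (# 1) j + offset U V (# 2) j ≡ 0ℤ
  offset-colSum U V zero             = offset-line (# 0) (# 0) (# 1) (# 0) (# 2) (# 0) refl refl U V
  offset-colSum U V (suc zero)       = offset-line (# 0) (# 1) (# 1) (# 1) (# 2) (# 1) refl refl U V
  offset-colSum U V (suc (suc zero)) = offset-line (# 0) (# 2) (# 1) (# 2) (# 2) (# 2) refl refl U V

  offset-diagSum : ∀ U V → offset U V (# 0) (# 0) + offset U V (# 1) (# 1) + offset U V (# 2) (# 2) ≡ 0ℤ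
  offset-diagSum = offset-line (# 0) (# 0) (# 1) (# 1) (# 2) (# 2) refl refl

  offset-antiDiagSum : ∀ U V → offset U V (# 0) (# 2) + offset U V (# 1) (# 1) + offset U V (# 2) (# 0) ≡ 0ℤ
  offset-antiDiagSum = offset-line (# 0) (# 2) (# 1) (# 1) (# 2) (# 0) refl refl

  pos-+₃ : ∀ a b c → + (a ℕ.+ b ℕ.+ c) ≡ + a + + b + + c
  pos-+₃ a b c = trans (ℤ.pos-+ (a ℕ.+ b) c) (cong (_+ + c) (ℤ.pos-+ a b))

  line-sum : ∀ {s U V M} {i₁ j₁ i₂ j₂ i₃ j₃} → Represents (+ s) U V M →
             offset U V i₁ j₁ + offset U V i₂ j₂ + offset U V i₃ j₃ ≡ 0ℤ →
             M i₁ j₁ ℕ.+ M i₂ j₂ ℕ.+ M i₃ j₃ ≡ 3 ℕ.* s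
  line-sum {s} {U} {V} {M} {i₁} {j₁} {i₂} {j₂} {i₃} {j₃} rep Σo≡0 = ℤ.+-injective (begin
    + (M i₁ j₁ ℕ.+ M i₂ j₂ ℕ.+ M i₃ j₃)          ≡⟨ pos-+₃ (M i₁ j₁) (M i₂ j₂) (M i₃ j₃) ⟩
    + M i₁ j₁ + + M i₂ j₂ + + M i₃ j₃            ≡⟨ cong₂ _+_ (cong₂ _+_ (rep i₁ j₁) (rep i₂ j₂)) (rep i₃ j₃) ⟩
    (+ s + o₁) + (+ s + o₂) + (+ s + o₃)         ≡⟨ regroup (+ s) o₁ o₂ o₃ ⟩
    + 3 * + s + (o₁ + o₂ + o₃)                   ≡⟨ cong (_+_ (+ 3 * + s)) Σo≡0 ⟩
    + 3 * + s + 0ℤ                               ≡⟨ ℤ.+-identityʳ _ ⟩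
    + 3 * + s                                    ≡⟨ ℤ.pos-* 3 s ⟨
    + (3 ℕ.* s)                                  ∎)
    where
    open ≡-Reasoning
    o₁ = offset U V i₁ j₁
    o₂ = offset U V i₂ j₂
    o₃ = offset U V i₃ j₃
    regroup : ∀ S o₁ o₂ o₃ → (S + o₁) + (S + o₂) + (S + o₃) ≡ + 3 * S + (o₁ + o₂ + o₃)
    regroup = ℤ-Solver.solve-∀

  represents⇒lineSums : ∀ {s U V M} → Represents (+ s) U V M → LineSums (3 ℕ.* s) M
  represents⇒lineSums {U = U} {V} rep =
    (λ i → line-sum rep (offset-rowSum U V i)) ,
    (λ j → line-sum rep (offset-colSum U V j)) ,
    line-sum rep (offset-diagSum U V) ,
    line-sum rep (offset-antiDiagSum U V)

  -- The four lines through the centre cover it four times and every other cell once.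
  centre : ∀ {s M} → LineSums (3 ℕ.* s) M → M (# 1) (# 1) ≡ s
  centre {s} {M} (rows , cols , diag , antiDiag) =
    ℕ.*-cancelˡ-≡ e s 3 (ℕ.+-cancelʳ-≡ (m ℕ.+ m ℕ.+ m) (3 ℕ.* e) m (begin
      3 ℕ.* e ℕ.+ (m ℕ.+ m ℕ.+ m)
        ≡⟨ cong (3 ℕ.* e ℕ.+_) rowsTotal ⟨
      3 ℕ.* e ℕ.+ (rowSum M (# 0) ℕ.+ rowSum M (# 1) ℕ.+ rowSum M (# 2))
        ≡⟨ through-centre (M (# 0) (# 0)) (M (# 0) (# 1)) (M (# 0) (# 2)) (M (# 1) (# 0)) e
                          (M (# 1) (# 2)) (M (# 2) (# 0)) (M (# 2) (# 1)) (M (# 2) (# 2)) ⟨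
      rowSum M (# 1) ℕ.+ colSum M (# 1) ℕ.+ diagSum M ℕ.+ antiDiagSum M
        ≡⟨ cong₂ ℕ._+_ (cong₂ ℕ._+_ (cong₂ ℕ._+_ (rows (# 1)) (cols (# 1))) diag) antiDiag ⟩
      m ℕ.+ m ℕ.+ m ℕ.+ m
        ≡⟨ ℕ.+-comm (m ℕ.+ m ℕ.+ m) m ⟩
      m ℕ.+ (m ℕ.+ m ℕ.+ m) ∎))
    where
    open ≡-Reasoning
    e = M (# 1) (# 1)
    m = 3 ℕ.* s
    rowsTotal : rowSum M (# 0) ℕ.+ rowSum M (# 1) ℕ.+ rowSum M (# 2) ≡ m ℕ.+ m ℕ.+ m
    rowsTotal = cong₂ ℕ._+_ (cong₂ ℕ._+_ (rows (# 0)) (rows (# 1))) (rows (# 2))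
    through-centre : ∀ a b c d e f g h i →
      (d ℕ.+ e ℕ.+ f) ℕ.+ (b ℕ.+ e ℕ.+ h) ℕ.+ (a ℕ.+ e ℕ.+ i) ℕ.+ (c ℕ.+ e ℕ.+ g)
      ≡ 3 ℕ.* e ℕ.+ ((a ℕ.+ b ℕ.+ c) ℕ.+ (d ℕ.+ e ℕ.+ f) ℕ.+ (g ℕ.+ h ℕ.+ i))
    through-centre = ℕ-Solver.solve-∀

  cast-line : ∀ {a b c s} → a ℕ.+ b ℕ.+ c ≡ 3 ℕ.* s → + a + + b + + c ≡ + 3 * + s
  cast-line {a} {b} {c} {s} eq = trans (sym (pos-+₃ a b c)) (trans (cong +_ eq) (ℤ.pos-* 3 s))

  line-last : ∀ {A B C S a b c} → A + B + C ≡ + 3 * S → a + b + c ≡ 0ℤ → A ≡ S + a → B ≡ S + b → C ≡ S + c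
  line-last {A} {B} {C} {S} {a} {b} {c} sum Σ≡0 refl refl = begin
    C                                          ≡⟨ isolate (S + a) (S + b) C ⟩
    (S + a) + (S + b) + C - (S + a) - (S + b)  ≡⟨ cong (λ t → t - (S + a) - (S + b)) sum ⟩
    + 3 * S - (S + a) - (S + b)                ≡⟨ rearrange S a b c ⟩
    S + c - (a + b + c)                        ≡⟨ cong (λ t → S + c - t) Σ≡0 ⟩
    S + c - 0ℤ                                 ≡⟨ ℤ.+-identityʳ (S + c) ⟩
    S + c                                      ∎
    where
    open ≡-Reasoning
    isolate : ∀ A B C → C ≡ A + B + C - A - B
    isolate = ℤ-Solver.solve-∀
    rearrange : ∀ S a b c → + 3 * S - (S + a) - (S + b) ≡ S + c - (a + b + c)
    rearrange = ℤ-Solver.solve-∀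

  line-middle : ∀ {A B C S a b c} → A + B + C ≡ + 3 * S → a + b + c ≡ 0ℤ → A ≡ S + a → C ≡ S + c → B ≡ S + b
  line-middle {A} {B} {C} {S} {a} {b} {c} sum Σ≡0 =
    line-last (trans (swap₂₃ A C B) sum) (trans (swap₂₃ a c b) Σ≡0)
    where
    swap₂₃ : ∀ x y z → x + y + z ≡ x + z + y
    swap₂₃ = ℤ-Solver.solve-∀

  first-entry : ∀ s x y → + x ≡ lucas (+ s) (paramU s x) (paramV s x y) (# 0) (# 0)
  first-entry s x y = identity (+ s) (+ x) (+ y)
    where
    identity : ∀ S X Y → X ≡ S + (+ 1 * (X - S) + + 0 * (+ 2 * S - X - Y))
    identity = ℤ-Solver.solve-∀

  second-entry : ∀ s x y → + y ≡ lucas (+ s) (paramU s x) (paramV s x y) (# 0) (# 1)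
  second-entry s x y = identity (+ s) (+ x) (+ y)
    where
    identity : ∀ S X Y → Y ≡ S + (- + 1 * (X - S) + - + 1 * (+ 2 * S - X - Y))
    identity = ℤ-Solver.solve-∀

  module _ (s : ℕ) (u v : ℤ) (M : Square) where

    line-entry-last : ∀ i₁ j₁ i₂ j₂ i₃ j₃ → M i₁ j₁ ℕ.+ M i₂ j₂ ℕ.+ M i₃ j₃ ≡ 3 ℕ.* s →
      offset u v i₁ j₁ + offset u v i₂ j₂ + offset u v i₃ j₃ ≡ 0ℤ →
      + M i₁ j₁ ≡ lucas (+ s) u v i₁ j₁ → + M i₂ j₂ ≡ lucas (+ s) u v i₂ j₂ → + M i₃ j₃ ≡ lucas (+ s) u v i₃ j₃
    line-entry-last i₁ j₁ i₂ j₂ i₃ j₃ sum =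
      line-last {+ M i₁ j₁} {+ M i₂ j₂} {+ M i₃ j₃} {+ s} {offset u v i₁ j₁} {offset u v i₂ j₂} {offset u v i₃ j₃}
                (cast-line {M i₁ j₁} {M i₂ j₂} {M i₃ j₃} {s} sum)

    line-entry-middle : ∀ i₁ j₁ i₂ j₂ i₃ j₃ → M i₁ j₁ ℕ.+ M i₂ j₂ ℕ.+ M i₃ j₃ ≡ 3 ℕ.* s →
      offset u v i₁ j₁ + offset u v i₂ j₂ + offset u v i₃ j₃ ≡ 0ℤ →
      + M i₁ j₁ ≡ lucas (+ s) u v i₁ j₁ → + M i₃ j₃ ≡ lucas (+ s) u v i₃ j₃ → + M i₂ j₂ ≡ lucas (+ s) u v i₂ j₂
    line-entry-middle i₁ j₁ i₂ j₂ i₃ j₃ sum =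
      line-middle {+ M i₁ j₁} {+ M i₂ j₂} {+ M i₃ j₃} {+ s} {offset u v i₁ j₁} {offset u v i₂ j₂} {offset u v i₃ j₃}
                  (cast-line {M i₁ j₁} {M i₂ j₂} {M i₃ j₃} {s} sum)

  lineSums⇒represents : ∀ {s M} → LineSums (3 ℕ.* s) M →
                        Represents (+ s) (paramU s (M (# 0) (# 0))) (paramV s (M (# 0) (# 0)) (M (# 0) (# 1))) M
  lineSums⇒represents {s} {M} sums@(rows , cols , diag , antiDiag) = entry
    where
    x = M (# 0) (# 0)
    y = M (# 0) (# 1)
    u = paramU s x
    v = paramV s x y
    last = line-entry-last s u v M
    middle = line-entry-middle s u v M
    e₁₁ : + M (# 1) (# 1) ≡ lucas (+ s) u v (# 1) (# 1)
    e₁₁ = trans (cong +_ (centre {s} {M} sums)) (no-offset (+ s) u v)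
      where
      no-offset : ∀ S u v → S ≡ S + (+ 0 * u + + 0 * v)
      no-offset = ℤ-Solver.solve-∀
    e₀₀ = first-entry s x y
    e₀₁ = second-entry s x y
    e₀₂ = last (# 0) (# 0) (# 0) (# 1) (# 0) (# 2) (rows (# 0)) (offset-rowSum u v (# 0)) e₀₀ e₀₁
    e₂₂ = last (# 0) (# 0) (# 1) (# 1) (# 2) (# 2) diag (offset-diagSum u v) e₀₀ e₁₁
    e₂₁ = last (# 0) (# 1) (# 1) (# 1) (# 2) (# 1) (cols (# 1)) (offset-colSum u v (# 1)) e₀₁ e₁₁
    e₂₀ = last (# 0) (# 2) (# 1) (# 1) (# 2) (# 0) antiDiag (offset-antiDiagSum u v) e₀₂ e₁₁
    e₁₀ = middle (# 0) (# 0) (# 1) (# 0) (# 2) (# 0) (cols (# 0)) (offset-colSum u v (# 0)) e₀₀ e₂₀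
    e₁₂ = last (# 1) (# 0) (# 1) (# 1) (# 1) (# 2) (rows (# 1)) (offset-rowSum u v (# 1)) e₁₀ e₁₁
    entry : Represents (+ s) u v M
    entry zero             zero             = e₀₀
    entry zero             (suc zero)       = e₀₁
    entry zero             (suc (suc zero)) = e₀₂
    entry (suc zero)       zero             = e₁₀
    entry (suc zero)       (suc zero)       = e₁₁
    entry (suc zero)       (suc (suc zero)) = e₁₂
    entry (suc (suc zero)) zero             = e₂₀
    entry (suc (suc zero)) (suc zero)       = e₂₁
    entry (suc (suc zero)) (suc (suc zero)) = e₂₂

module Distinctness where

  open import Data.Integer using (ℤ; +_; 0ℤ; _+_; _-_; _*_; -_; _≟_)
  import Data.Integer.Properties as ℤ
  import Data.Integer.Tactic.RingSolver as ℤ-Solver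
  open import Data.Fin using (Fin; #_)
  import Data.Fin.Properties as Fin
  open import Data.List using (List; []; _∷_)
  open import Data.List.Relation.Unary.All as All using (All)
  open import Data.List.Relation.Unary.Any as Any using (Any)
  open import Data.Product using (_×_; _,_; proj₁; ∃)
  open import Data.Sum using (_⊎_; inj₁; inj₂; [_,_]′)
  open import Data.Empty using (⊥-elim)
  open import Function using (_⇔_; mk⇔; Equivalence; id)
  open import Function.Properties.Equivalence using (⇔-setoid)
  open import Level using (0ℓ)
  import Relation.Binary.Reasoning.Setoid as SetoidReasoning
  open import Relation.Nullary using (Dec; ¬_; ¬?)
  open import Relation.Nullary.Decidable using (_×-dec_; _⊎-dec_; toWitness)
  open import Relation.Binary.PropositionalEquality
  open import Algebra.Properties.AbelianGroup ℤ.+-0-abelianGroup using (∙-cancelˡ)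
  open import Defs
  open Parametrisation

  module ⇔-Reasoning = SetoidReasoning (⇔-setoid 0ℓ)

  OffsetInjective : ℤ → ℤ → Set
  OffsetInjective U V = ∀ i j k l → offset U V i j ≡ offset U V k l → i ≡ k × j ≡ l

  represents⇒distinct⇔offsetInjective : ∀ {S U V M} → Represents S U V M → Distinct M ⇔ OffsetInjective U V
  represents⇒distinct⇔offsetInjective {S} {U} {V} {M} rep = mk⇔
    (λ distinct i j k l eq →
       distinct i j k l (ℤ.+-injective (trans (rep i j) (trans (cong (_+_ S) eq) (sym (rep k l))))))
    (λ inj i j k l eq →
       inj i j k l (∙-cancelˡ S _ _ (trans (sym (rep i j)) (trans (cong +_ eq) (rep k l)))))

  slopes : List ℤ
  slopes = + 0 ∷ + 1 ∷ - + 1 ∷ + 2 ∷ - + 2 ∷ + 4 ∷ - + 4 ∷ []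

  AvoidsLines : ℤ → ℤ → Set
  AvoidsLines U V = ¬ U ≡ 0ℤ × All (λ β → ¬ + 2 * V ≡ β * U) slopes

  avoidsLines? : ∀ U V → Dec (AvoidsLines U V)
  avoidsLines? U V = ¬? (U ≟ 0ℤ) ×-dec All.all? (λ β → ¬? (+ 2 * V ≟ β * U)) slopes

  ΔP ΔQ : Fin 3 → Fin 3 → Fin 3 → Fin 3 → ℤ
  ΔP i j k l = P i j - P k l
  ΔQ i j k l = Q i j - Q k l

  offset-difference : ∀ U V i j k l → offset U V i j - offset U V k l ≡ ΔP i j k l * U + ΔQ i j k l * V
  offset-difference U V i j k l = expand (P i j) (Q i j) (P k l) (Q k l) U V
    where
    expand : ∀ p q p′ q′ U V → (p * U + q * V) - (p′ * U + q′ * V) ≡ (p - p′) * U + (q - q′) * V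
    expand = ℤ-Solver.solve-∀

  ≡⇔difference≡0 : ∀ {a b} → a ≡ b ⇔ a - b ≡ 0ℤ
  ≡⇔difference≡0 {a} {b} = mk⇔ (λ a≡b → trans (cong (_- b) a≡b) (ℤ.+-inverseʳ b)) (ℤ.i-j≡0⇒i≡j a b)

  *≡0⇔≡0 : ∀ {c d} → ¬ c ≡ 0ℤ → c * d ≡ 0ℤ ⇔ d ≡ 0ℤ
  *≡0⇔≡0 {c} {d} c≢0 = mk⇔ (λ cd≡0 → [ (λ c≡0 → ⊥-elim (c≢0 c≡0)) , id ]′ (ℤ.i*j≡0⇒i≡0∨j≡0 c cd≡0))
                            (λ d≡0 → trans (cong (c *_) d≡0) (ℤ.*-zeroʳ c))

  -- Two cells carry equal offsets exactly on the axis U = 0 when their coefficient difference is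
  -- (ΔP, 0) with ΔP ≠ 0, and exactly on the line 2V = βU when c · (ΔP, ΔQ) = (−β, 2).
  OnAxis : Fin 3 → Fin 3 → Fin 3 → Fin 3 → Set
  OnAxis i j k l = ΔQ i j k l ≡ 0ℤ × ¬ ΔP i j k l ≡ 0ℤ

  multipliers : List ℤ
  multipliers = + 1 ∷ - + 1 ∷ + 2 ∷ - + 2 ∷ []

  OnSlope : ℤ → Fin 3 → Fin 3 → Fin 3 → Fin 3 → Set
  OnSlope β i j k l = Any (λ c → c * ΔQ i j k l ≡ + 2 × c * ΔP i j k l ≡ - β) multipliers

  onSlope? : ∀ β i j k l → Dec (OnSlope β i j k l)
  onSlope? β i j k l = Any.any? (λ c → (c * ΔQ i j k l ≟ + 2) ×-dec (c * ΔP i j k l ≟ - β)) multipliers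

  axis-difference : ∀ U V i j k l → ΔQ i j k l ≡ 0ℤ → offset U V i j - offset U V k l ≡ ΔP i j k l * U
  axis-difference U V i j k l ΔQ≡0 = begin
    offset U V i j - offset U V k l        ≡⟨ offset-difference U V i j k l ⟩
    ΔP i j k l * U + ΔQ i j k l * V        ≡⟨ cong (λ q → ΔP i j k l * U + q * V) ΔQ≡0 ⟩
    ΔP i j k l * U + 0ℤ                    ≡⟨ ℤ.+-identityʳ _ ⟩
    ΔP i j k l * U                         ∎
    where open ≡-Reasoning

  scaled-difference : ∀ U V β c i j k l → c * ΔQ i j k l ≡ + 2 → c * ΔP i j k l ≡ - β →
                      c * (offset U V i j - offset U V k l) ≡ + 2 * V - β * U
  scaled-difference U V β c i j k l cΔQ≡2 cΔP≡-β = begin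
    c * (offset U V i j - offset U V k l)        ≡⟨ cong (c *_) (offset-difference U V i j k l) ⟩
    c * (ΔP i j k l * U + ΔQ i j k l * V)        ≡⟨ distribute c (ΔP i j k l) (ΔQ i j k l) U V ⟩
    c * ΔQ i j k l * V - - (c * ΔP i j k l) * U  ≡⟨ cong₂ (λ a b → a * V - - b * U) cΔQ≡2 cΔP≡-β ⟩
    + 2 * V - - - β * U                          ≡⟨ cong (λ b → + 2 * V - b * U) (ℤ.neg-involutive β) ⟩
    + 2 * V - β * U                              ∎
    where
    open ≡-Reasoning
    distribute : ∀ c p q U V → c * (p * U + q * V) ≡ c * q * V - - (c * p) * U
    distribute = ℤ-Solver.solve-∀

  multiplier≢0 : ∀ {c q} → c * q ≡ + 2 → ¬ c ≡ 0ℤ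
  multiplier≢0 cq≡2 refl with () ← cq≡2

  on-axis⇔ : ∀ {U V} i j k l → OnAxis i j k l → offset U V i j ≡ offset U V k l ⇔ U ≡ 0ℤ
  on-axis⇔ {U} {V} i j k l (ΔQ≡0 , ΔP≢0) = begin
    offset U V i j ≡ offset U V k l        ≈⟨ ≡⇔difference≡0 ⟩
    offset U V i j - offset U V k l ≡ 0ℤ   ≈⟨ mk⇔ (trans (sym difference)) (trans difference) ⟩
    ΔP i j k l * U ≡ 0ℤ                    ≈⟨ *≡0⇔≡0 ΔP≢0 ⟩
    U ≡ 0ℤ                                 ∎
    where
    open ⇔-Reasoning
    difference = axis-difference U V i j k l ΔQ≡0

  on-slope⇔ : ∀ {U V β} i j k l → OnSlope β i j k l → offset U V i j ≡ offset U V k l ⇔ + 2 * V ≡ β * U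
  on-slope⇔ {U} {V} {β} i j k l onSlope = via (Any.satisfied onSlope)
    where
    open ⇔-Reasoning
    via : ∃ (λ c → c * ΔQ i j k l ≡ + 2 × c * ΔP i j k l ≡ - β) → offset U V i j ≡ offset U V k l ⇔ + 2 * V ≡ β * U
    via (c , cΔQ≡2 , cΔP≡-β) = begin
      offset U V i j ≡ offset U V k l             ≈⟨ ≡⇔difference≡0 ⟩
      offset U V i j - offset U V k l ≡ 0ℤ        ≈⟨ *≡0⇔≡0 (multiplier≢0 {c} {ΔQ i j k l} cΔQ≡2) ⟨
      c * (offset U V i j - offset U V k l) ≡ 0ℤ  ≈⟨ mk⇔ (trans (sym scaled)) (trans scaled) ⟩
      + 2 * V - β * U ≡ 0ℤ                        ≈⟨ ≡⇔difference≡0 ⟨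
      + 2 * V ≡ β * U                             ∎
      where
      scaled = scaled-difference U V β c i j k l cΔQ≡2 cΔP≡-β

  distinct-cells-lie-on-a-line : ∀ i j k l →
    (i ≡ k × j ≡ l) ⊎ OnAxis i j k l ⊎ Any (λ β → OnSlope β i j k l) slopes
  distinct-cells-lie-on-a-line = toWitness {a? = Fin.all? λ i → Fin.all? λ j → Fin.all? λ k → Fin.all? λ l →
    ((i Fin.≟ k) ×-dec (j Fin.≟ l))
    ⊎-dec ((ΔQ i j k l ≟ 0ℤ) ×-dec ¬? (ΔP i j k l ≟ 0ℤ))
    ⊎-dec Any.any? (λ β → onSlope? β i j k l) slopes} _

  LineThroughTwoCells : ℤ → Set
  LineThroughTwoCells β = ∃ λ i → ∃ λ j → ∃ λ k → ∃ λ l → ¬ (i ≡ k × j ≡ l) × OnSlope β i j k l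

  every-slope-meets-two-cells : All LineThroughTwoCells slopes
  every-slope-meets-two-cells = toWitness {a? = All.all? (λ β →
    Fin.any? λ i → Fin.any? λ j → Fin.any? λ k → Fin.any? λ l →
    ¬? ((i Fin.≟ k) ×-dec (j Fin.≟ l)) ×-dec onSlope? β i j k l) slopes} _

  offsetInjective⇒avoidsLines : ∀ {U V} → OffsetInjective U V → AvoidsLines U V
  offsetInjective⇒avoidsLines {U} {V} inj = U≢0 , All.map avoids every-slope-meets-two-cells
    where
    U≢0 : ¬ U ≡ 0ℤ
    U≢0 U≡0 with () ← proj₁ (inj (# 0) (# 0) (# 1) (# 1)
                        (Equivalence.from (on-axis⇔ {U} {V} (# 0) (# 0) (# 1) (# 1) (refl , λ ())) U≡0))
    avoids : ∀ {β} → LineThroughTwoCells β → ¬ + 2 * V ≡ β * U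
    avoids (i , j , k , l , different , onSlope) onLine =
      different (inj i j k l (Equivalence.from (on-slope⇔ i j k l onSlope) onLine))

  avoidsLines⇒offsetInjective : ∀ {U V} → AvoidsLines U V → OffsetInjective U V
  avoidsLines⇒offsetInjective {U} {V} (U≢0 , avoids) i j k l eq = separate (distinct-cells-lie-on-a-line i j k l)
    where
    separate : (i ≡ k × j ≡ l) ⊎ OnAxis i j k l ⊎ Any (λ β → OnSlope β i j k l) slopes → i ≡ k × j ≡ l
    separate (inj₁ same)            = same
    separate (inj₂ (inj₁ onAxis))   = ⊥-elim (U≢0 (Equivalence.to (on-axis⇔ i j k l onAxis) eq))
    separate (inj₂ (inj₂ onSlopes)) =
      let offLine , onSlope = All.lookupAny avoids onSlopes
      in  ⊥-elim (offLine (Equivalence.to (on-slope⇔ i j k l onSlope) eq))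

module Completions where

  open import Data.Nat as ℕ using (ℕ)
  import Data.Nat.Properties as ℕ
  open import Data.Integer using (ℤ; +_; 0ℤ; ∣_∣; _≤_; _≤?_; +≤+)
  import Data.Integer.Properties as ℤ
  open import Data.Fin using (Fin; zero; suc; #_)
  import Data.Fin.Properties as Fin
  open import Data.Vec using (Vec; []; _∷_)
  open import Data.Vec.Relation.Unary.All using ([]; _∷_) renaming (All to AllV)
  open import Data.Product using (_×_; _,_; proj₁; proj₂)
  open import Function using (Equivalence)
  open import Relation.Nullary using (Dec)
  open import Relation.Nullary.Decidable using (_×-dec_)
  open import Relation.Binary.PropositionalEquality
  open import Defs
  open Sums
  open Counting
  open Parametrisation
  open Distinctness

  Admissible : ℤ → ℤ → ℤ → Set
  Admissible S U V = (∀ i j → 0ℤ ≤ lucas S U V i j) × AvoidsLines U V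

  admissible? : ∀ S U V → Dec (Admissible S U V)
  admissible? S U V = Fin.all? (λ i → Fin.all? λ j → 0ℤ ≤? lucas S U V i j) ×-dec avoidsLines? U V

  completion : ℕ → ℕ → ℕ → Vec ℕ 7
  completion s x y =
    e (# 0) (# 2) ∷ e (# 1) (# 0) ∷ e (# 1) (# 1) ∷ e (# 1) (# 2) ∷ e (# 2) (# 0) ∷ e (# 2) (# 1) ∷ e (# 2) (# 2) ∷ []
    where
    e : Fin 3 → Fin 3 → ℕ
    e i j = ∣ lucas (+ s) (paramU s x) (paramV s x y) i j ∣

  entry≤rowSum : ∀ M i j → M i j ℕ.≤ rowSum M i
  entry≤rowSum M i zero             = ℕ.≤-trans (ℕ.m≤m+n (M i (# 0)) (M i (# 1))) (ℕ.m≤m+n _ (M i (# 2)))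
  entry≤rowSum M i (suc zero)       = ℕ.≤-trans (ℕ.m≤n+m (M i (# 1)) (M i (# 0))) (ℕ.m≤m+n _ (M i (# 2)))
  entry≤rowSum M i (suc (suc zero)) = ℕ.m≤n+m (M i (# 2)) (M i (# 0) ℕ.+ M i (# 1))

  module _ (s x y : ℕ) where

    private
      u = paramU s x
      v = paramV s x y
      Completed : Vec ℕ 7 → Square
      Completed w = toSquare (x ∷ y ∷ w)

    magic⇒completion : ∀ w → IsMagic (3 ℕ.* s) (Completed w) → w ≡ completion s x y × Admissible (+ s) u v
    magic⇒completion w@(_ ∷ _ ∷ _ ∷ _ ∷ _ ∷ _ ∷ _ ∷ []) (distinct , sums) =
      w≡ , (λ i j → subst (0ℤ ≤_) (rep i j) (+≤+ ℕ.z≤n)) ,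
      offsetInjective⇒avoidsLines (Equivalence.to (represents⇒distinct⇔offsetInjective {+ s} {u} {v} rep) distinct)
      where
      rep : Represents (+ s) u v (Completed w)
      rep = lineSums⇒represents {s} {Completed w} sums
      entry : ∀ i j → Completed w i j ≡ ∣ lucas (+ s) u v i j ∣
      entry i j = cong ∣_∣ (rep i j)
      w≡ : w ≡ completion s x y
      w≡ = cong₂ _∷_ (entry (# 0) (# 2)) (cong₂ _∷_ (entry (# 1) (# 0)) (cong₂ _∷_ (entry (# 1) (# 1))
           (cong₂ _∷_ (entry (# 1) (# 2)) (cong₂ _∷_ (entry (# 2) (# 0)) (cong₂ _∷_ (entry (# 2) (# 1))
           (cong₂ _∷_ (entry (# 2) (# 2)) refl))))))

    admissible⇒represents : Admissible (+ s) u v → Represents (+ s) u v (Completed (completion s x y))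
    admissible⇒represents (nonneg , _) = entry
      where
      entry : Represents (+ s) u v (Completed (completion s x y))
      entry zero             zero             = first-entry s x y
      entry zero             (suc zero)       = second-entry s x y
      entry zero             (suc (suc zero)) = ℤ.0≤i⇒+∣i∣≡i (nonneg (# 0) (# 2))
      entry (suc zero)       zero             = ℤ.0≤i⇒+∣i∣≡i (nonneg (# 1) (# 0))
      entry (suc zero)       (suc zero)       = ℤ.0≤i⇒+∣i∣≡i (nonneg (# 1) (# 1))
      entry (suc zero)       (suc (suc zero)) = ℤ.0≤i⇒+∣i∣≡i (nonneg (# 1) (# 2))
      entry (suc (suc zero)) zero             = ℤ.0≤i⇒+∣i∣≡i (nonneg (# 2) (# 0))
      entry (suc (suc zero)) (suc zero)       = ℤ.0≤i⇒+∣i∣≡i (nonneg (# 2) (# 1))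
      entry (suc (suc zero)) (suc (suc zero)) = ℤ.0≤i⇒+∣i∣≡i (nonneg (# 2) (# 2))

    admissible⇒magic : Admissible (+ s) u v → IsMagic (3 ℕ.* s) (Completed (completion s x y))
    admissible⇒magic adm@(_ , avoids) =
      Equivalence.from (represents⇒distinct⇔offsetInjective {+ s} {u} {v} rep) (avoidsLines⇒offsetInjective avoids) ,
      represents⇒lineSums {s} {u} {v} rep
      where
      rep = admissible⇒represents adm

    admissible⇒bounded : Admissible (+ s) u v → AllV (ℕ._≤ 3 ℕ.* s) (completion s x y)
    admissible⇒bounded adm = ≤m (# 0) (# 2) ∷ ≤m (# 1) (# 0) ∷ ≤m (# 1) (# 1) ∷ ≤m (# 1) (# 2) ∷
                             ≤m (# 2) (# 0) ∷ ≤m (# 2) (# 1) ∷ ≤m (# 2) (# 2) ∷ []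
      where
      M = Completed (completion s x y)
      ≤m : ∀ i j → M i j ℕ.≤ 3 ℕ.* s
      ≤m i j = subst (M i j ℕ.≤_) (proj₁ (proj₂ (admissible⇒magic adm)) i) (entry≤rowSum M i j)

  rowCount : ℕ → ℕ → ℕ
  rowCount s x = ∑[ y < ℕ.suc (3 ℕ.* s) ] indicator (admissible? (+ s) (paramU s x) (paramV s x y))

  count-completions : ∀ s x y →
    count (λ w → isMagic? (3 ℕ.* s) (toSquare (x ∷ y ∷ w))) (tuples (3 ℕ.* s) 7) ≡
    indicator (admissible? (+ s) (paramU s x) (paramV s x y))
  count-completions s x y =
    count-tuples-indicator (3 ℕ.* s) 7 (completion s x y) (admissible? (+ s) (paramU s x) (paramV s x y))
      (λ w → isMagic? (3 ℕ.* s) (toSquare (x ∷ y ∷ w)))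
      (magic⇒completion s x y) (admissible⇒magic s x y) (admissible⇒bounded s x y)

  magicCount-rows : ∀ s → magicCount (3 ℕ.* s) ≡ ∑[ x < ℕ.suc (3 ℕ.* s) ] rowCount s x
  magicCount-rows s = trans (magicCount-∑ (3 ℕ.* s))
    (∑-cong (ℕ.suc (3 ℕ.* s)) λ x _ → ∑-cong (ℕ.suc (3 ℕ.* s)) λ y _ → count-completions s x y)

module Halves where

  open import Data.Nat
  open import Data.Nat.Properties
  open import Data.Nat.DivMod using (_/_; _%_; m*n/n≡m; /-monoˡ-≤; m/n*n≤m; [m+kn]%n≡m%n; m*n%n≡0)
  import Data.Nat.Tactic.RingSolver as ℕ-Solver
  open import Function using (_⇔_; mk⇔)
  open import Data.Product using (_×_; _,_; ∃)
  open import Relation.Nullary using (Dec; yes; no; ¬_)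
  open import Relation.Nullary.Decidable using (_×-dec_; map′)
  open import Relation.Binary.PropositionalEquality
  open Sums

  HalfAtMost : ℕ → ℕ → Set
  HalfAtMost k r = ∃ λ b → k ≡ 2 * b × b ≤ r

  halfAtMost? : ∀ k r → Dec (HalfAtMost k r)
  halfAtMost? k r = map′ (λ (2[k/2]≡k , k/2≤r) → k / 2 , sym 2[k/2]≡k , k/2≤r) witness
    ((2 * (k / 2) ≟ k) ×-dec (k / 2 ≤? r))
    where
    witness : HalfAtMost k r → 2 * (k / 2) ≡ k × k / 2 ≤ r
    witness (b , k≡2b , b≤r) = trans (cong (2 *_) k/2≡b) (sym k≡2b) , subst (_≤ r) (sym k/2≡b) b≤r
      where
      k/2≡b : k / 2 ≡ b
      k/2≡b = trans (cong (_/ 2) (trans k≡2b (*-comm 2 b))) (m*n/n≡m b 2)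

  double-cancel : ∀ {m n} → 2 * m ≡ 2 * n → m ≡ n
  double-cancel {m} {n} = *-cancelˡ-≡ m n 2

  2[m∸n]+2n : ∀ {m n} → n ≤ m → 2 * (m ∸ n) + 2 * n ≡ 2 * m
  2[m∸n]+2n {m} {n} n≤m = trans (sym (*-distribˡ-+ 2 (m ∸ n) n)) (cong (2 *_) (m∸n+n≡m n≤m))

  2y+k≡2r⇒half : ∀ {y k r} → 2 * y + k ≡ 2 * r → HalfAtMost k r
  2y+k≡2r⇒half {y} {k} {r} eq = r ∸ y , k≡2[r∸y] , m∸n≤m r y
    where
    y≤r : y ≤ r
    y≤r = *-cancelˡ-≤ 2 (≤-trans (m≤m+n (2 * y) k) (≤-reflexive eq))
    k≡2[r∸y] : k ≡ 2 * (r ∸ y)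
    k≡2[r∸y] = +-cancelˡ-≡ (2 * y) k _ (trans eq (trans (sym (2[m∸n]+2n y≤r)) (+-comm _ (2 * y))))

  2y≡2r+k⇒half : ∀ {y k r} → y ≤ 2 * r → 2 * y ≡ 2 * r + k → HalfAtMost k r
  2y≡2r+k⇒half {y} {k} {r} y≤2r eq = y ∸ r , k≡2[y∸r] , y∸r≤r
    where
    r≤y : r ≤ y
    r≤y = *-cancelˡ-≤ 2 (≤-trans (m≤m+n (2 * r) k) (≤-reflexive (sym eq)))
    k≡2[y∸r] : k ≡ 2 * (y ∸ r)
    k≡2[y∸r] = +-cancelˡ-≡ (2 * r) k _ (trans (sym eq) (trans (sym (2[m∸n]+2n r≤y)) (+-comm _ (2 * r))))
    y∸r≤r : y ∸ r ≤ r
    y∸r≤r = ≤-trans (∸-monoˡ-≤ r y≤2r) (≤-reflexive (trans (cong (λ t → r + t ∸ r) (+-identityʳ r)) (m+n∸m≡n r r)))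

  module _ (k r N : ℕ) (2r<N : 2 * r < N) where

    ∑-solutions-below : ∑[ y < N ] indicator ((y ≤? 2 * r) ×-dec (2 * y + k ≟ 2 * r)) ≡
                        indicator (halfAtMost? k r)
    ∑-solutions-below with halfAtMost? k r
    ... | no ¬half = ∑-indicator-none _ N λ y _ (_ , eq) → ¬half (2y+k≡2r⇒half {y} eq)
    ... | yes (b , k≡2b , b≤r) = ∑-indicator-single _ (r ∸ b) N (≤-<-trans r∸b≤2r 2r<N)
            (λ y (_ , eq) → double-cancel (+-cancelʳ-≡ k _ _ (trans eq (sym solution))))
            (r∸b≤2r , solution)
      where
      r∸b≤2r : r ∸ b ≤ 2 * r
      r∸b≤2r = ≤-trans (m∸n≤m r b) (m≤m+n r _)
      solution : 2 * (r ∸ b) + k ≡ 2 * r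
      solution = trans (cong (2 * (r ∸ b) +_) k≡2b) (2[m∸n]+2n b≤r)

    ∑-solutions-above : ∑[ y < N ] indicator ((y ≤? 2 * r) ×-dec (2 * y ≟ 2 * r + k)) ≡
                        indicator (halfAtMost? k r)
    ∑-solutions-above with halfAtMost? k r
    ... | no ¬half = ∑-indicator-none _ N λ y _ (y≤2r , eq) → ¬half (2y≡2r+k⇒half {y} y≤2r eq)
    ... | yes (b , k≡2b , b≤r) = ∑-indicator-single _ (r + b) N (≤-<-trans r+b≤2r 2r<N)
            (λ y (_ , eq) → double-cancel (trans eq (sym solution)))
            (r+b≤2r , solution)
      where
      r+b≤2r : r + b ≤ 2 * r
      r+b≤2r = ≤-trans (+-monoʳ-≤ r b≤r) (≤-reflexive (cong (r +_) (sym (+-identityʳ r))))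
      solution : 2 * (r + b) ≡ 2 * r + k
      solution = trans (*-distribˡ-+ 2 r b) (cong (2 * r +_) (sym k≡2b))

  halfAtMost-∸⇔ : ∀ {k m n s c} → n ≤ s → k ≡ 2 * m → m + n ≡ c → HalfAtMost k (s ∸ n) ⇔ c ≤ s
  halfAtMost-∸⇔ {k} {m} {n} {s} {c} n≤s k≡2m m+n≡c = mk⇔
    (λ (b , k≡2b , b≤s∸n) → subst (_≤ s) m+n≡c
      (m≤o∸n⇒m+n≤o m n≤s (subst (_≤ s ∸ n) (double-cancel (trans (sym k≡2b) k≡2m)) b≤s∸n)))
    (λ c≤s → m , k≡2m , m+n≤o⇒m≤o∸n m (subst (_≤ s) (sym m+n≡c) c≤s))

  ∑-multiples : ∀ m s n .{{_ : NonZero m}} → s / m ≤ n → ∑[ i < n ] indicator (m * suc i ≤? s) ≡ s / m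
  ∑-multiples m s n s/m≤n = ∑-indicator-prefix (λ i → m * suc i ≤? s) (s / m) n s/m≤n
    (λ i _ m[1+i]≤s → subst (_≤ s / m) (trans (cong (_/ m) (*-comm m (suc i))) (m*n/n≡m (suc i) m))
                                         (/-monoˡ-≤ m m[1+i]≤s))
    (λ i i<s/m → ≤-trans (*-monoʳ-≤ m i<s/m) (subst (_≤ s) (*-comm (s / m) m) (m/n*n≤m s m)))

  odd-not-half : ∀ {k j r} → k ≡ suc (j + j) → ¬ HalfAtMost k r
  odd-not-half {j = j} refl (b , k≡2b , _) = 1≢0 (begin
    1                      ≡⟨ [m+kn]%n≡m%n 1 j 2 ⟨
    (1 + j * 2) % 2        ≡⟨ cong (_% 2) (trans (odd j) k≡2b) ⟩
    (2 * b) % 2            ≡⟨ cong (_% 2) (*-comm 2 b) ⟩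
    (b * 2) % 2            ≡⟨ m*n%n≡0 b 2 ⟩
    0                      ∎)
    where
    open ≡-Reasoning
    odd : ∀ j → 1 + j * 2 ≡ suc (j + j)
    odd = ℕ-Solver.solve-∀
    1≢0 : ¬ 1 ≡ 0
    1≢0 ()

module Rows where

  open import Data.Nat as ℕ using (ℕ; zero; suc; _≤?_; z≤n)
  import Data.Nat.Properties as ℕ
  open import Data.Integer using (+_; 0ℤ; _+_; _-_; _*_; -_; _≤_; _≟_; +≤+)
  import Data.Integer.Properties as ℤ
  import Data.Integer.Tactic.RingSolver as ℤ-Solver
  open import Data.Fin using (zero; suc; #_; opposite)
  import Data.Fin.Properties as Fin
  open import Data.List.Relation.Unary.All as All using (All)
  open import Data.Product using (_×_; _,_; proj₁; proj₂)
  open import Function using (_⇔_; mk⇔; id)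
  open import Function.Properties.Equivalence using () renaming (trans to ⇔-trans)
  open import Relation.Nullary using (Dec; ¬_; ¬?)
  open import Relation.Nullary.Decidable using (_×-dec_; toWitness)
  open import Relation.Binary.PropositionalEquality
  open Parametrisation
  open Distinctness
  open Completions

  opposite-coefficients : ∀ i j →
    P (opposite i) (opposite j) ≡ - P i j × Q (opposite i) (opposite j) ≡ - Q i j
  opposite-coefficients = toWitness {a? = Fin.all? λ i → Fin.all? λ j →
    (P (opposite i) (opposite j) ≟ - P i j) ×-dec (Q (opposite i) (opposite j) ≟ - Q i j)} _

  lucas-neg : ∀ S U V i j → lucas S (- U) (- V) i j ≡ lucas S U V (opposite i) (opposite j)
  lucas-neg S U V i j = begin
    S + (P i j * - U + Q i j * - V)
      ≡⟨ move-signs S (P i j) (Q i j) U V ⟩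
    S + (- P i j * U + - Q i j * V)
      ≡⟨ cong₂ (λ p q → S + (p * U + q * V)) (sym P-opp) (sym Q-opp) ⟩
    S + (P (opposite i) (opposite j) * U + Q (opposite i) (opposite j) * V) ∎
    where
    open ≡-Reasoning
    P-opp = proj₁ (opposite-coefficients i j)
    Q-opp = proj₂ (opposite-coefficients i j)
    move-signs : ∀ S p q U V → S + (p * - U + q * - V) ≡ S + (- p * U + - q * V)
    move-signs = ℤ-Solver.solve-∀

  avoidsLines-neg : ∀ {U V} → AvoidsLines U V → AvoidsLines (- U) (- V)
  avoidsLines-neg {U} {V} (U≢0 , avoids) =
    (λ -U≡0 → U≢0 (ℤ.neg-injective -U≡0)) ,
    All.map (λ {β} offLine onLine → offLine (ℤ.neg-injective (trans (ℤ.neg-distribʳ-* (+ 2) V)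
      (trans onLine (sym (ℤ.neg-distribʳ-* β U)))))) avoids

  admissible-neg : ∀ {S U V} → Admissible S U V → Admissible S (- U) (- V)
  admissible-neg {S} {U} {V} (nonneg , avoids) =
    (λ i j → subst (0ℤ ≤_) (sym (lucas-neg S U V i j)) (nonneg (opposite i) (opposite j))) ,
    avoidsLines-neg avoids

  admissible-neg⇔ : ∀ {S U V} → Admissible S (- U) (- V) ⇔ Admissible S U V
  admissible-neg⇔ {S} {U} {V} = mk⇔
    (λ adm → subst₂ (Admissible S) (ℤ.neg-involutive U) (ℤ.neg-involutive V) (admissible-neg {S} adm))
    (admissible-neg {S})

  0≤2m-n⇒n≤2m : ∀ {m n} → 0ℤ ≤ + 2 * + m - + n → n ℕ.≤ 2 ℕ.* m
  0≤2m-n⇒n≤2m {m} {n} 0≤2m-n = ℤ.drop‿+≤+ (subst (+ n ≤_) (sym (ℤ.pos-* 2 m)) (ℤ.0≤i-j⇒j≤i 0≤2m-n))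

  n≤2m⇒0≤2m-n : ∀ {m n} → n ℕ.≤ 2 ℕ.* m → 0ℤ ≤ + 2 * + m - + n
  n≤2m⇒0≤2m-n {m} {n} n≤2m = ℤ.i≤j⇒0≤j-i (subst (+ n ≤_) (ℤ.pos-* 2 m) (+≤+ n≤2m))

  admissible⇒x≤2s : ∀ {s x y} → Admissible (+ s) (paramU s x) (paramV s x y) → x ℕ.≤ 2 ℕ.* s
  admissible⇒x≤2s {s} {x} {y} (nonneg , _) =
    0≤2m-n⇒n≤2m {s} {x} (subst (0ℤ ≤_) (cell₂₂ (+ s) (+ x) (+ y)) (nonneg (# 2) (# 2)))
    where
    cell₂₂ : ∀ S X Y → S + (- + 1 * (X - S) + + 0 * (+ 2 * S - X - Y)) ≡ + 2 * S - X
    cell₂₂ = ℤ-Solver.solve-∀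

  admissible⇒y≤2s : ∀ {s x y} → Admissible (+ s) (paramU s x) (paramV s x y) → y ℕ.≤ 2 ℕ.* s
  admissible⇒y≤2s {s} {x} {y} (nonneg , _) =
    0≤2m-n⇒n≤2m {s} {y} (subst (0ℤ ≤_) (cell₂₁ (+ s) (+ x) (+ y)) (nonneg (# 2) (# 1)))
    where
    cell₂₁ : ∀ S X Y → S + (+ 1 * (X - S) + + 1 * (+ 2 * S - X - Y)) ≡ + 2 * S - Y
    cell₂₁ = ℤ-Solver.solve-∀

  centre-inadmissible : ∀ {s y} → ¬ Admissible (+ s) (paramU s s) (paramV s s y)
  centre-inadmissible {s} (_ , U≢0 , _) = U≢0 (ℤ.+-inverseʳ (+ s))

  -- In the row x = s + a of the count, with s = a + r, the parameters are U = a and V = r − y.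
  RowAdmissible : ℕ → ℕ → ℕ → Set
  RowAdmissible a r y = y ℕ.≤ 2 ℕ.* r × All (λ β → ¬ + 2 * (+ r - + y) ≡ β * + a) slopes

  rowAdmissible? : ∀ a r y → Dec (RowAdmissible a r y)
  rowAdmissible? a r y = (y ≤? 2 ℕ.* r) ×-dec All.all? (λ β → ¬? (+ 2 * (+ r - + y) ≟ β * + a)) slopes

  row-cell₁₀ : ∀ A R Y → (A + R) + (- + 1 * A + + 1 * (R - Y)) ≡ + 2 * R - Y
  row-cell₁₀ = ℤ-Solver.solve-∀

  row-nonneg : ∀ {a r y} → y ℕ.≤ 2 ℕ.* r → ∀ i j → 0ℤ ≤ lucas (+ a + + r) (+ a) (+ r - + y) i j
  row-nonneg {a} {r} {y} y≤2r = cell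
    where
    A = + a
    R = + r
    Y = + y
    _⊕_ : ∀ {b c} → 0ℤ ≤ b → 0ℤ ≤ c → 0ℤ ≤ b + c
    _⊕_ = ℤ.+-mono-≤
    infixl 6 _⊕_
    0≤A = +≤+ (z≤n {a})
    0≤R = +≤+ (z≤n {r})
    0≤Y = +≤+ (z≤n {y})
    0≤2R-Y = n≤2m⇒0≤2m-n {r} {y} y≤2r
    cell₀₀ : ∀ A R Y → (A + R) + (+ 1 * A + + 0 * (R - Y)) ≡ A + A + R
    cell₀₀ = ℤ-Solver.solve-∀
    cell₀₁ : ∀ A R Y → (A + R) + (- + 1 * A + - + 1 * (R - Y)) ≡ Y
    cell₀₁ = ℤ-Solver.solve-∀
    cell₀₂ : ∀ A R Y → (A + R) + (+ 0 * A + + 1 * (R - Y)) ≡ A + (+ 2 * R - Y)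
    cell₀₂ = ℤ-Solver.solve-∀
    cell₁₁ : ∀ A R Y → (A + R) + (+ 0 * A + + 0 * (R - Y)) ≡ A + R
    cell₁₁ = ℤ-Solver.solve-∀
    cell₁₂ : ∀ A R Y → (A + R) + (+ 1 * A + - + 1 * (R - Y)) ≡ A + A + Y
    cell₁₂ = ℤ-Solver.solve-∀
    cell₂₀ : ∀ A R Y → (A + R) + (+ 0 * A + - + 1 * (R - Y)) ≡ A + Y
    cell₂₀ = ℤ-Solver.solve-∀
    cell₂₁ : ∀ A R Y → (A + R) + (+ 1 * A + + 1 * (R - Y)) ≡ A + A + (+ 2 * R - Y)
    cell₂₁ = ℤ-Solver.solve-∀
    cell₂₂ : ∀ A R Y → (A + R) + (- + 1 * A + + 0 * (R - Y)) ≡ R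
    cell₂₂ = ℤ-Solver.solve-∀
    cell : ∀ i j → 0ℤ ≤ lucas (A + R) A (R - Y) i j
    cell zero             zero             = subst (0ℤ ≤_) (sym (cell₀₀ A R Y)) (0≤A ⊕ 0≤A ⊕ 0≤R)
    cell zero             (suc zero)       = subst (0ℤ ≤_) (sym (cell₀₁ A R Y)) 0≤Y
    cell zero             (suc (suc zero)) = subst (0ℤ ≤_) (sym (cell₀₂ A R Y)) (0≤A ⊕ 0≤2R-Y)
    cell (suc zero)       zero             = subst (0ℤ ≤_) (sym (row-cell₁₀ A R Y)) 0≤2R-Y
    cell (suc zero)       (suc zero)       = subst (0ℤ ≤_) (sym (cell₁₁ A R Y)) (0≤A ⊕ 0≤R)
    cell (suc zero)       (suc (suc zero)) = subst (0ℤ ≤_) (sym (cell₁₂ A R Y)) (0≤A ⊕ 0≤A ⊕ 0≤Y)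
    cell (suc (suc zero)) zero             = subst (0ℤ ≤_) (sym (cell₂₀ A R Y)) (0≤A ⊕ 0≤Y)
    cell (suc (suc zero)) (suc zero)       = subst (0ℤ ≤_) (sym (cell₂₁ A R Y)) (0≤A ⊕ 0≤A ⊕ 0≤2R-Y)
    cell (suc (suc zero)) (suc (suc zero)) = subst (0ℤ ≤_) (sym (cell₂₂ A R Y)) 0≤R

  admissible⇔rowAdmissible : ∀ {a r y} .{{_ : ℕ.NonZero a}} →
                             Admissible (+ a + + r) (+ a) (+ r - + y) ⇔ RowAdmissible a r y
  admissible⇔rowAdmissible {a} {r} {y} = mk⇔
    (λ (nonneg , _ , avoids) →
       0≤2m-n⇒n≤2m {r} {y} (subst (0ℤ ≤_) (row-cell₁₀ (+ a) (+ r) (+ y)) (nonneg (# 1) (# 0))) , avoids)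
    (λ (y≤2r , avoids) → row-nonneg y≤2r , a≢0 , avoids)
    where
    a≢0 : ¬ + a ≡ 0ℤ
    a≢0 a≡0 = ℕ.≢-nonZero⁻¹ a (ℤ.+-injective a≡0)

  admissible-cong : ∀ {S S′ U U′ V V′} → S ≡ S′ → U ≡ U′ → V ≡ V′ → Admissible S U V ⇔ Admissible S′ U′ V′
  admissible-cong refl refl refl = mk⇔ id id

  row-direct : ∀ a r y →
    Admissible (+ (a ℕ.+ r)) (paramU (a ℕ.+ r) (a ℕ.+ r ℕ.+ a)) (paramV (a ℕ.+ r) (a ℕ.+ r ℕ.+ a) y) ⇔
    Admissible (+ a + + r) (+ a) (+ r - + y)
  row-direct a r y = admissible-cong +s≡A+R U≡ V≡
    where
    s = a ℕ.+ r
    +s≡A+R : + s ≡ + a + + r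
    +s≡A+R = ℤ.pos-+ a r
    U≡ : paramU s (s ℕ.+ a) ≡ + a
    U≡ = trans (cong (_- + s) (ℤ.pos-+ s a)) (cancel (+ s) (+ a))
      where
      cancel : ∀ S A → (S + A) - S ≡ A
      cancel = ℤ-Solver.solve-∀
    V≡ : paramV s (s ℕ.+ a) y ≡ + r - + y
    V≡ = trans (cong₂ (λ S X → + 2 * S - X - + y) +s≡A+R (trans (ℤ.pos-+ s a) (cong (_+ + a) +s≡A+R)))
               (identity (+ a) (+ r) (+ y))
      where
      identity : ∀ A R Y → + 2 * (A + R) - ((A + R) + A) - Y ≡ R - Y
      identity = ℤ-Solver.solve-∀

  -- The row x = s − a, read backwards (y ↦ 2s − y), is the half-turn image of the row x = s + a.
  row-mirror : ∀ a r i → i ℕ.≤ 2 ℕ.* (a ℕ.+ r) →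
    Admissible (+ (a ℕ.+ r)) (paramU (a ℕ.+ r) r) (paramV (a ℕ.+ r) r (2 ℕ.* (a ℕ.+ r) ℕ.∸ i)) ⇔
    Admissible (+ a + + r) (+ a) (+ r - + i)
  row-mirror a r i i≤2s = ⇔-trans (admissible-cong +s≡A+R U≡ V≡) (admissible-neg⇔ {+ a + + r})
    where
    s = a ℕ.+ r
    +s≡A+R : + s ≡ + a + + r
    +s≡A+R = ℤ.pos-+ a r
    U≡ : paramU s r ≡ - + a
    U≡ = trans (cong (_-_ (+ r)) +s≡A+R) (identity (+ a) (+ r))
      where
      identity : ∀ A R → R - (A + R) ≡ - A
      identity = ℤ-Solver.solve-∀
    +2s-i : + (2 ℕ.* s ℕ.∸ i) ≡ + 2 * (+ a + + r) - + i
    +2s-i = trans (sym (trans (ℤ.m-n≡m⊖n (2 ℕ.* s) i) (ℤ.⊖-≥ i≤2s)))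
                  (cong (_- + i) (trans (ℤ.pos-* 2 s) (cong (+ 2 *_) +s≡A+R)))
    V≡ : paramV s r (2 ℕ.* s ℕ.∸ i) ≡ - (+ r - + i)
    V≡ = trans (cong₂ (λ S Y → + 2 * S - + r - Y) +s≡A+R +2s-i) (identity (+ a) (+ r) (+ i))
      where
      identity : ∀ A R I → + 2 * (A + R) - R - (+ 2 * (A + R) - I) ≡ - (R - I)
      identity = ℤ-Solver.solve-∀

module RowCounts where

  open import Data.Nat as ℕ using (ℕ; suc; _≤?_; z≤n; s≤s)
  import Data.Nat.Properties as ℕ
  import Data.Nat.Tactic.RingSolver as ℕ-Solver
  open import Data.Nat.ListAction using (sum)
  open import Data.Integer using (ℤ; +_; -[1+_]; _+_; _-_; _*_; -_; ∣_∣; _≟_)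
  import Data.Integer.Properties as ℤ
  import Data.Integer.Tactic.RingSolver as ℤ-Solver
  open import Data.List using (map)
  open import Data.List.Properties using (map-cong)
  open import Data.List.Relation.Unary.All as All using ()
  open import Data.List.Relation.Unary.AllPairs as AllPairs using (AllPairs; allPairs?)
  open import Data.Product using (_×_; _,_; proj₂)
  open import Function using (_⇔_; mk⇔)
  open import Function.Properties.Equivalence using () renaming (refl to ⇔-refl; trans to ⇔-trans)
  open import Data.Product.Function.NonDependent.Propositional using (_×-⇔_)
  open import Relation.Nullary using (Dec; yes; no; ¬_; ¬?)
  open import Relation.Nullary.Decidable using (_×-dec_; toWitness)
  open import Relation.Binary.PropositionalEquality
  open Sums
  open Halves
  open Parametrisation
  open Distinctness
  open Completions
  open Rows

  OnRowLine : ℤ → ℕ → ℕ → ℕ → Set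
  OnRowLine β a r y = y ℕ.≤ 2 ℕ.* r × + 2 * (+ r - + y) ≡ β * + a

  onRowLine? : ∀ β a r y → Dec (OnRowLine β a r y)
  onRowLine? β a r y = (y ≤? 2 ℕ.* r) ×-dec (+ 2 * (+ r - + y) ≟ β * + a)

  rowLineCount : ℕ → ℕ → ℕ
  rowLineCount a r = sum (map (λ β → indicator (halfAtMost? (∣ β ∣ ℕ.* a) r)) slopes)

  slopes-distinct : AllPairs (λ β β′ → ¬ β ≡ β′) slopes
  slopes-distinct = toWitness {a? = allPairs? (λ β β′ → ¬? (β ≟ β′)) slopes} _

  rowAdmissible+onRowLines≡inRange : ∀ {a r y} .{{_ : ℕ.NonZero a}} →
    indicator (rowAdmissible? a r y) ℕ.+ sum (map (λ β → indicator (onRowLine? β a r y)) slopes) ≡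
    indicator (y ≤? 2 ℕ.* r)
  rowAdmissible+onRowLines≡inRange {a} {r} {y} = by-cases (y ≤? 2 ℕ.* r)
    where
    online? : ∀ β → Dec (+ 2 * (+ r - + y) ≡ β * + a)
    online? β = + 2 * (+ r - + y) ≟ β * + a
    exclusive : ∀ {β β′} → ¬ β ≡ β′ → ¬ (+ 2 * (+ r - + y) ≡ β * + a × + 2 * (+ r - + y) ≡ β′ * + a)
    exclusive β≢β′ (e , e′) = β≢β′ (ℤ.*-cancelʳ-≡ _ _ (+ a) (trans (sym e) e′))
    admissible = indicator (rowAdmissible? a r y)
    onLines = sum (map (λ β → indicator (onRowLine? β a r y)) slopes)
    by-cases : Dec (y ℕ.≤ 2 ℕ.* r) → admissible ℕ.+ onLines ≡ indicator (y ≤? 2 ℕ.* r)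
    by-cases (no y≰2r) = begin
      admissible ℕ.+ onLines
        ≡⟨ cong₂ ℕ._+_ (indicator-no (rowAdmissible? a r y) (λ (y≤2r , _) → y≰2r y≤2r))
             (cong sum (map-cong (λ β → indicator-no (onRowLine? β a r y) (λ (y≤2r , _) → y≰2r y≤2r)) slopes)) ⟩
      0                                     ≡⟨ indicator-no (y ≤? 2 ℕ.* r) y≰2r ⟨
      indicator (y ≤? 2 ℕ.* r)              ∎
      where open ≡-Reasoning
    by-cases (yes y≤2r) = begin
      admissible ℕ.+ onLines
        ≡⟨ cong₂ ℕ._+_ (indicator-cong (rowAdmissible? a r y) (All.all? (λ β → ¬? (online? β)) slopes) (mk⇔ proj₂ (y≤2r ,_)))
             (cong sum (map-cong (λ β → indicator-cong (onRowLine? β a r y) (online? β) (mk⇔ proj₂ (y≤2r ,_))) slopes)) ⟩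
      indicator (All.all? (λ β → ¬? (online? β)) slopes) ℕ.+ sum (map (λ β → indicator (online? β)) slopes)
        ≡⟨ exclusive-none+count≡1 online? slopes (AllPairs.map exclusive slopes-distinct) ⟩
      1                                     ≡⟨ indicator-yes (y ≤? 2 ℕ.* r) y≤2r ⟨
      indicator (y ≤? 2 ℕ.* r)              ∎
      where open ≡-Reasoning

  ≡⇔≡-by-difference : ∀ {D B m n} → D - B ≡ + m - + n → D ≡ B ⇔ n ≡ m
  ≡⇔≡-by-difference {D} {B} {m} {n} D-B≡m-n = mk⇔
    (λ D≡B → sym (ℤ.+-injective (ℤ.i-j≡0⇒i≡j (+ m) (+ n)
      (trans (sym D-B≡m-n) (trans (cong (_- B) D≡B) (ℤ.+-inverseʳ B))))))
    (λ n≡m → ℤ.i-j≡0⇒i≡j D B (trans D-B≡m-n (trans (cong (λ k → + m - + k) n≡m) (ℤ.+-inverseʳ (+ m)))))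

  ∑-onRowLine : ∀ β a r N → 2 ℕ.* r ℕ.< N →
                ∑[ y < N ] indicator (onRowLine? β a r y) ≡ indicator (halfAtMost? (∣ β ∣ ℕ.* a) r)
  ∑-onRowLine (+ k) a r N 2r<N = trans
    (∑-indicator-cong (onRowLine? (+ k) a r) (λ y → (y ≤? 2 ℕ.* r) ×-dec (2 ℕ.* y ℕ.+ k ℕ.* a ℕ.≟ 2 ℕ.* r)) N
      λ y _ → ⇔-refl ×-⇔ line⇔ y)
    (∑-solutions-below (k ℕ.* a) r N 2r<N)
    where
    line⇔ : ∀ y → + 2 * (+ r - + y) ≡ + k * + a ⇔ 2 ℕ.* y ℕ.+ k ℕ.* a ≡ 2 ℕ.* r
    line⇔ y = ≡⇔≡-by-difference (begin
      + 2 * (+ r - + y) - + k * + a           ≡⟨ regroup (+ r) (+ y) (+ k) (+ a) ⟩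
      + 2 * + r - (+ 2 * + y + + k * + a)
        ≡⟨ cong₂ _-_ (ℤ.pos-* 2 r) (trans (ℤ.pos-+ (2 ℕ.* y) (k ℕ.* a)) (cong₂ _+_ (ℤ.pos-* 2 y) (ℤ.pos-* k a))) ⟨
      + (2 ℕ.* r) - + (2 ℕ.* y ℕ.+ k ℕ.* a)   ∎)
      where
      open ≡-Reasoning
      regroup : ∀ R Y K A → + 2 * (R - Y) - K * A ≡ + 2 * R - (+ 2 * Y + K * A)
      regroup = ℤ-Solver.solve-∀
  ∑-onRowLine -[1+ k ] a r N 2r<N = trans
    (∑-indicator-cong (onRowLine? -[1+ k ] a r) (λ y → (y ≤? 2 ℕ.* r) ×-dec (2 ℕ.* y ℕ.≟ 2 ℕ.* r ℕ.+ suc k ℕ.* a)) N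
      λ y _ → ⇔-refl ×-⇔ line⇔ y)
    (∑-solutions-above (suc k ℕ.* a) r N 2r<N)
    where
    line⇔ : ∀ y → + 2 * (+ r - + y) ≡ - + suc k * + a ⇔ 2 ℕ.* y ≡ 2 ℕ.* r ℕ.+ suc k ℕ.* a
    line⇔ y = ≡⇔≡-by-difference (begin
      + 2 * (+ r - + y) - - + suc k * + a     ≡⟨ regroup (+ r) (+ y) (+ suc k) (+ a) ⟩
      (+ 2 * + r + + suc k * + a) - + 2 * + y
        ≡⟨ cong₂ _-_ (trans (ℤ.pos-+ (2 ℕ.* r) (suc k ℕ.* a)) (cong₂ _+_ (ℤ.pos-* 2 r) (ℤ.pos-* (suc k) a)))
                     (ℤ.pos-* 2 y) ⟨
      + (2 ℕ.* r ℕ.+ suc k ℕ.* a) - + (2 ℕ.* y) ∎)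
      where
      open ≡-Reasoning
      regroup : ∀ R Y K A → + 2 * (R - Y) - - K * A ≡ (+ 2 * R + K * A) - + 2 * Y
      regroup = ℤ-Solver.solve-∀

  ∑-rowAdmissible+rowLineCount : ∀ a r N .{{_ : ℕ.NonZero a}} → 2 ℕ.* r ℕ.< N →
                                 ∑[ y < N ] indicator (rowAdmissible? a r y) ℕ.+ rowLineCount a r ≡ suc (2 ℕ.* r)
  ∑-rowAdmissible+rowLineCount a r N 2r<N = begin
    ∑[ y < N ] admissible y ℕ.+ rowLineCount a r
      ≡⟨ cong (∑[ y < N ] admissible y ℕ.+_) (cong sum (map-cong (λ β → ∑-onRowLine β a r N 2r<N) slopes)) ⟨
    ∑[ y < N ] admissible y ℕ.+ sum (map (λ β → ∑[ y < N ] onLine β y) slopes)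
      ≡⟨ cong (∑[ y < N ] admissible y ℕ.+_) (∑-sum-comm (λ y β → onLine β y) N slopes) ⟨
    ∑[ y < N ] admissible y ℕ.+ ∑[ y < N ] sum (map (λ β → onLine β y) slopes)
      ≡⟨ ∑-distrib-+ N ⟨
    ∑[ y < N ] (admissible y ℕ.+ sum (map (λ β → onLine β y) slopes))
      ≡⟨ ∑-cong N (λ y _ → rowAdmissible+onRowLines≡inRange) ⟩
    ∑[ y < N ] indicator (y ≤? 2 ℕ.* r)
      ≡⟨ ∑-indicator-prefix (_≤? 2 ℕ.* r) (suc (2 ℕ.* r)) N 2r<N (λ y _ → s≤s) (λ y → ℕ.≤-pred) ⟩
    suc (2 ℕ.* r) ∎
    where
    open ≡-Reasoning
    admissible = λ y → indicator (rowAdmissible? a r y)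
    onLine = λ β y → indicator (onRowLine? β a r y)

  2r<1+2[a+r] : ∀ a r → 2 ℕ.* r ℕ.< suc (2 ℕ.* (a ℕ.+ r))
  2r<1+2[a+r] a r = s≤s (ℕ.*-monoʳ-≤ 2 (ℕ.m≤n+m r a))

  2r<1+3[a+r] : ∀ a r → 2 ℕ.* r ℕ.< suc (3 ℕ.* (a ℕ.+ r))
  2r<1+3[a+r] a r = ℕ.<-≤-trans (2r<1+2[a+r] a r) (s≤s (ℕ.*-monoˡ-≤ (a ℕ.+ r) (s≤s (s≤s (z≤n {1})))))

  right-row : ∀ {s a r} .{{_ : ℕ.NonZero a}} → a ℕ.+ r ≡ s → rowCount s (s ℕ.+ a) ℕ.+ rowLineCount a r ≡ suc (2 ℕ.* r)
  right-row {a = a} {r} refl = begin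
    rowCount (a ℕ.+ r) (a ℕ.+ r ℕ.+ a) ℕ.+ rowLineCount a r
      ≡⟨ cong (ℕ._+ rowLineCount a r) (∑-indicator-cong _ (rowAdmissible? a r) N λ y _ →
           ⇔-trans (row-direct a r y) (admissible⇔rowAdmissible {a} {r} {y})) ⟩
    ∑[ y < N ] indicator (rowAdmissible? a r y) ℕ.+ rowLineCount a r
      ≡⟨ ∑-rowAdmissible+rowLineCount a r N (2r<1+3[a+r] a r) ⟩
    suc (2 ℕ.* r) ∎
    where
    open ≡-Reasoning
    N = suc (3 ℕ.* (a ℕ.+ r))

  left-row : ∀ {s a r} .{{_ : ℕ.NonZero a}} → a ℕ.+ r ≡ s → rowCount s r ℕ.+ rowLineCount a r ≡ suc (2 ℕ.* r)
  left-row {a = a} {r} refl = begin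
    rowCount s r ℕ.+ rowLineCount a r
      ≡⟨ cong (λ n → ∑ n f ℕ.+ rowLineCount a r) (split-3s s) ⟩
    ∑ (suc (2 ℕ.* s) ℕ.+ s) f ℕ.+ rowLineCount a r
      ≡⟨ cong (ℕ._+ rowLineCount a r) (∑-split f (suc (2 ℕ.* s)) s) ⟩
    ∑ (suc (2 ℕ.* s)) f ℕ.+ ∑[ i < s ] f (suc (2 ℕ.* s) ℕ.+ i) ℕ.+ rowLineCount a r
      ≡⟨ cong (λ t → ∑ (suc (2 ℕ.* s)) f ℕ.+ t ℕ.+ rowLineCount a r) (∑-zero s λ i _ →
           indicator-no (admissible? (+ s) (paramU s r) (paramV s r (suc (2 ℕ.* s) ℕ.+ i))) λ adm →
             ℕ.<⇒≱ (s≤s (ℕ.m≤m+n (2 ℕ.* s) i)) (admissible⇒y≤2s {s} {r} {suc (2 ℕ.* s) ℕ.+ i} adm)) ⟩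
    ∑ (suc (2 ℕ.* s)) f ℕ.+ 0 ℕ.+ rowLineCount a r
      ≡⟨ cong (ℕ._+ rowLineCount a r) (trans (ℕ.+-identityʳ _) (∑-reverse f (suc (2 ℕ.* s)))) ⟩
    ∑[ i < suc (2 ℕ.* s) ] f (2 ℕ.* s ℕ.∸ i) ℕ.+ rowLineCount a r
      ≡⟨ cong (ℕ._+ rowLineCount a r) (∑-indicator-cong _ (rowAdmissible? a r) (suc (2 ℕ.* s)) λ i i<1+2s →
           ⇔-trans (row-mirror a r i (ℕ.≤-pred i<1+2s)) (admissible⇔rowAdmissible {a} {r} {i})) ⟩
    ∑[ i < suc (2 ℕ.* s) ] indicator (rowAdmissible? a r i) ℕ.+ rowLineCount a r
      ≡⟨ ∑-rowAdmissible+rowLineCount a r (suc (2 ℕ.* s)) (2r<1+2[a+r] a r) ⟩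
    suc (2 ℕ.* r) ∎
    where
    open ≡-Reasoning
    s = a ℕ.+ r
    f = λ y → indicator (admissible? (+ s) (paramU s r) (paramV s r y))
    split-3s : ∀ s → suc (3 ℕ.* s) ≡ suc (2 ℕ.* s) ℕ.+ s
    split-3s = ℕ-Solver.solve-∀

module Totals where

  open import Data.Nat
  open import Data.Nat.Properties
  open import Data.Nat.DivMod using (_/_; _%_; m/n≤m; /-monoʳ-≤; m≡m%n+[m/n]*n; m%n<n)
  import Data.Nat.Tactic.RingSolver as ℕ-Solver
  import Data.Integer as ℤ
  open import Data.Integer using (∣_∣)
  open import Data.Product using (_,_)
  open import Data.List using (map)
  open import Data.Nat.ListAction using (sum)
  open import Relation.Nullary using (¬_)
  open import Relation.Binary.PropositionalEquality
  open import Defs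
  open Sums
  open Halves
  open Parametrisation
  open Distinctness
  open Completions
  open Rows
  open RowCounts

  lineTotal : ℕ → ℕ
  lineTotal s = ∑[ i < s ] rowLineCount (suc i) (s ∸ suc i)

  ∑-row+rowLineCount : ∀ s (row : ℕ → ℕ) →
    (∀ i → i < s → row i + rowLineCount (suc i) (s ∸ suc i) ≡ suc (2 * (s ∸ suc i))) → ∑ s row + lineTotal s ≡ s * s
  ∑-row+rowLineCount s row row+lines = begin
    ∑ s row + lineTotal s                                  ≡⟨ ∑-distrib-+ s ⟨
    ∑[ i < s ] (row i + rowLineCount (suc i) (s ∸ suc i))  ≡⟨ ∑-cong s row+lines ⟩
    ∑[ i < s ] suc (2 * (s ∸ suc i))                       ≡⟨ ∑-reverse (λ i → suc (2 * i)) s ⟨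
    ∑[ i < s ] suc (2 * i)                                 ≡⟨ ∑-odd s ⟩
    s * s                                                  ∎
    where open ≡-Reasoning

  magicCount-sides : ∀ s → magicCount (3 * s) ≡ ∑[ i < s ] rowCount s (s ∸ suc i) + ∑[ i < s ] rowCount s (s + suc i)
  magicCount-sides s = begin
    magicCount (3 * s)                                      ≡⟨ magicCount-rows s ⟩
    ∑ (suc (3 * s)) row                                     ≡⟨ cong (λ n → ∑ n row) (split s) ⟩
    ∑ (s + suc (s + s)) row                                 ≡⟨ ∑-split row s (suc (s + s)) ⟩
    ∑ s row + ∑[ j < suc (s + s) ] row (s + j)
      ≡⟨ cong₂ _+_ (∑-reverse row s) (∑-split (λ j → row (s + j)) 1 (s + s)) ⟩
    Left + (row (s + 0) + ∑[ j < s + s ] row (s + suc j))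
      ≡⟨ cong (λ t → Left + (t + ∑[ j < s + s ] row (s + suc j))) middle ⟩
    Left + ∑[ j < s + s ] row (s + suc j)                   ≡⟨ cong (Left +_) (∑-split (λ j → row (s + suc j)) s s) ⟩
    Left + (Right + ∑[ j < s ] row (s + suc (s + j)))       ≡⟨ cong (λ t → Left + (Right + t)) beyond ⟩
    Left + (Right + 0)                                      ≡⟨ cong (Left +_) (+-identityʳ Right) ⟩
    Left + Right                                            ∎
    where
    open ≡-Reasoning
    row = rowCount s
    Left = ∑[ i < s ] row (s ∸ suc i)
    Right = ∑[ i < s ] row (s + suc i)
    split : ∀ s → suc (3 * s) ≡ s + suc (s + s)
    split = ℕ-Solver.solve-∀
    middle : row (s + 0) ≡ 0
    middle = ∑-zero (suc (3 * s)) λ y _ → indicator-no (admissible? (ℤ.+ s) (paramU s (s + 0)) (paramV s (s + 0) y))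
      (subst (λ x → ¬ Admissible (ℤ.+ s) (paramU s x) (paramV s x y)) (sym (+-identityʳ s))
             (centre-inadmissible {s} {y}))
    beyond : ∑[ j < s ] row (s + suc (s + j)) ≡ 0
    beyond = ∑-zero s λ j _ → ∑-zero (suc (3 * s)) λ y _ →
      indicator-no (admissible? (ℤ.+ s) (paramU s (s + suc (s + j))) (paramV s (s + suc (s + j)) y))
        λ adm → <⇒≱ (2s<x j) (admissible⇒x≤2s {s} {s + suc (s + j)} {y} adm)
      where
      2s<x : ∀ j → 2 * s < s + suc (s + j)
      2s<x j = subst (2 * s <_) (sym (+-suc s (s + j)))
                     (s≤s (+-monoʳ-≤ s (≤-trans (≤-reflexive (+-identityʳ s)) (m≤m+n s j))))

  magicCount+2lineTotal : ∀ s → magicCount (3 * s) + 2 * lineTotal s ≡ 2 * (s * s)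
  magicCount+2lineTotal s = begin
    magicCount (3 * s) + 2 * lineTotal s          ≡⟨ cong (_+ 2 * lineTotal s) (magicCount-sides s) ⟩
    (Left + Right) + 2 * lineTotal s              ≡⟨ regroup Left Right (lineTotal s) ⟩
    (Left + lineTotal s) + (Right + lineTotal s)  ≡⟨ cong₂ _+_ (∑-row+rowLineCount s _ left) (∑-row+rowLineCount s _ right) ⟩
    s * s + s * s                                 ≡⟨ cong (s * s +_) (+-identityʳ (s * s)) ⟨
    2 * (s * s)                                   ∎
    where
    open ≡-Reasoning
    Left = ∑[ i < s ] rowCount s (s ∸ suc i)
    Right = ∑[ i < s ] rowCount s (s + suc i)
    regroup : ∀ a b c → (a + b) + 2 * c ≡ (a + c) + (b + c)
    regroup = ℕ-Solver.solve-∀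
    left : ∀ i → i < s → rowCount s (s ∸ suc i) + rowLineCount (suc i) (s ∸ suc i) ≡ suc (2 * (s ∸ suc i))
    left i i<s = left-row (m+[n∸m]≡n i<s)
    right : ∀ i → i < s → rowCount s (s + suc i) + rowLineCount (suc i) (s ∸ suc i) ≡ suc (2 * (s ∸ suc i))
    right i i<s = right-row (m+[n∸m]≡n i<s)

  halfAtMostCount : ℕ → ℕ → ℕ
  halfAtMostCount k s = ∑[ i < s ] indicator (halfAtMost? (k * suc i) (s ∸ suc i))

  halfAtMostCount-0 : ∀ s → halfAtMostCount 0 s ≡ s
  halfAtMostCount-0 s = trans (∑-cong s λ i _ → indicator-yes (halfAtMost? 0 (s ∸ suc i)) (0 , refl , z≤n))
                              (trans (∑-const 1 s) (*-identityʳ s))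

  halfAtMostCount-2 : ∀ s → halfAtMostCount 2 s ≡ s / 2
  halfAtMostCount-2 s =
    trans (∑-indicator-cong _ (λ i → 2 * suc i ≤? s) s λ i i<s → halfAtMost-∸⇔ {m = suc i} i<s refl (double (suc i)))
          (∑-multiples 2 s s (m/n≤m s 2))
    where
    double : ∀ m → m + m ≡ 2 * m
    double = ℕ-Solver.solve-∀

  halfAtMostCount-4 : ∀ s → halfAtMostCount 4 s ≡ s / 3
  halfAtMostCount-4 s =
    trans (∑-indicator-cong _ (λ i → 3 * suc i ≤? s) s λ i i<s →
             halfAtMost-∸⇔ {m = 2 * suc i} i<s (quadruple (suc i)) (triple (suc i)))
          (∑-multiples 3 s s (m/n≤m s 3))
    where
    quadruple : ∀ m → 4 * m ≡ 2 * (2 * m)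
    quadruple = ℕ-Solver.solve-∀
    triple : ∀ m → 2 * m + m ≡ 3 * m
    triple = ℕ-Solver.solve-∀

  -- Only even a = 2(j + 1) contribute, and for them HalfAtMost a (s − a) says 3(j + 1) ≤ s.
  halfAtMostCount-1 : ∀ s → halfAtMostCount 1 s ≡ s / 3
  halfAtMostCount-1 s = begin
    ∑ s f                                                  ≡⟨ cong (λ k → ∑ k f) s≡n+n+ρ ⟩
    ∑ (n + n + ρ) f                                        ≡⟨ ∑-split f (n + n) ρ ⟩
    ∑ (n + n) f + ∑[ i < ρ ] f (n + n + i)                 ≡⟨ cong₂ _+_ (∑-pairs f n) (∑-zero ρ last-odd) ⟩
    ∑[ j < n ] (f (j + j) + f (suc (j + j))) + 0           ≡⟨ +-identityʳ _ ⟩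
    ∑[ j < n ] (f (j + j) + f (suc (j + j)))               ≡⟨ ∑-cong n (λ j _ → cong (_+ f (suc (j + j))) (even j)) ⟩
    ∑[ j < n ] f (suc (j + j))
      ≡⟨ ∑-indicator-cong _ (λ j → 3 * suc j ≤? s) n (λ j j<n →
           halfAtMost-∸⇔ {m = suc j} (2+2j≤s j<n) (trans (*-identityˡ (suc (suc (j + j)))) (evens j)) (thrice j)) ⟩
    ∑[ j < n ] indicator (3 * suc j ≤? s)                  ≡⟨ ∑-multiples 3 s n (/-monoʳ-≤ s (s≤s (s≤s (z≤n {1})))) ⟩
    s / 3                                                  ∎
    where
    open ≡-Reasoning
    f = λ i → indicator (halfAtMost? (1 * suc i) (s ∸ suc i))
    n = s / 2
    ρ = s % 2
    s≡n+n+ρ : s ≡ n + n + ρ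
    s≡n+n+ρ = trans (m≡m%n+[m/n]*n s 2) (reorder ρ n)
      where
      reorder : ∀ ρ n → ρ + n * 2 ≡ n + n + ρ
      reorder = ℕ-Solver.solve-∀
    evens : ∀ j → suc (suc (j + j)) ≡ 2 * suc j
    evens = ℕ-Solver.solve-∀
    thrice : ∀ j → suc j + suc (suc (j + j)) ≡ 3 * suc j
    thrice = ℕ-Solver.solve-∀
    even : ∀ j → f (j + j) ≡ 0
    even j = indicator-no (halfAtMost? _ _) (odd-not-half {j = j} (*-identityˡ (suc (j + j))))
    last-odd : ∀ i → i < ρ → f (n + n + i) ≡ 0
    last-odd zero    _     = trans (cong f (+-identityʳ (n + n))) (even n)
    last-odd (suc i) 2+i≤ρ with s≤s () ← ≤-trans 2+i≤ρ (≤-pred (m%n<n s 2))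
    2+2j≤s : ∀ {j} → j < n → suc (suc (j + j)) ≤ s
    2+2j≤s {j} j<n = ≤-trans (subst (_≤ n + n) (cong suc (+-suc j j)) (+-mono-≤ j<n j<n))
                             (≤-trans (m≤m+n (n + n) ρ) (≤-reflexive (sym s≡n+n+ρ)))

  lineTotal-closed : ∀ s → lineTotal s ≡ s + 2 * (s / 2) + 4 * (s / 3)
  lineTotal-closed s = begin
    lineTotal s
      ≡⟨ ∑-sum-comm (λ i β → indicator (halfAtMost? (∣ β ∣ * suc i) (s ∸ suc i))) s slopes ⟩
    sum (map (λ β → halfAtMostCount ∣ β ∣ s) slopes)
      ≡⟨ cong₂ _+_ (halfAtMostCount-0 s) (cong₂ _+_ (halfAtMostCount-1 s) (cong₂ _+_ (halfAtMostCount-1 s)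
           (cong₂ _+_ (halfAtMostCount-2 s) (cong₂ _+_ (halfAtMostCount-2 s)
           (cong₂ _+_ (halfAtMostCount-4 s) (cong (_+ 0) (halfAtMostCount-4 s))))))) ⟩
    s + (s / 3 + (s / 3 + (s / 2 + (s / 2 + (s / 3 + (s / 3 + 0))))))
      ≡⟨ collect s (s / 2) (s / 3) ⟩
    s + 2 * (s / 2) + 4 * (s / 3) ∎
    where
    open ≡-Reasoning
    collect : ∀ s h t → s + (t + (t + (h + (h + (t + (t + 0)))))) ≡ s + 2 * h + 4 * t
    collect = ℕ-Solver.solve-∀

  magicCount-closed : ∀ s → magicCount (3 * s) + (2 * s + 4 * (s / 2) + 8 * (s / 3)) ≡ 2 * (s * s)
  magicCount-closed s =
    trans (cong (magicCount (3 * s) +_) (trans (double s (s / 2) (s / 3)) (cong (2 *_) (sym (lineTotal-closed s)))))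
          (magicCount+2lineTotal s)
    where
    double : ∀ s h t → 2 * s + 4 * h + 8 * t ≡ 2 * (s + 2 * h + 4 * t)
    double = ℕ-Solver.solve-∀

module ClosedFormula where

  open import Data.Nat as ℕ using (zero; suc)
  import Data.Nat.Properties as ℕ
  open import Data.Nat.DivMod using (_/_; _%_; m≡m%n+[m/n]*n; [m+n]%n≡m%n)
  open import Data.Integer as ℤ using (+_)
  import Data.Integer.Properties as ℤ
  open import Data.Rational as ℚ using (ℚ; 1ℚ; mkℚ)
  import Data.Rational.Properties as ℚ
  open import Data.Rational.Solver using (module +-*-Solver)
  open import Data.Nat.Coprimality as Coprime using (1-coprimeTo)
  open import Algebra.Properties.Group ℚ.+-0-group using (⁻¹-involutive)
  open import Relation.Binary.PropositionalEquality
  open import Defs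
  open Totals

  nℚ≡mkℚ : ∀ n → nℚ n ≡ mkℚ (+ n) 0 (Coprime.sym (1-coprimeTo n))
  nℚ≡mkℚ n = ℚ.normalize-coprime (Coprime.sym (1-coprimeTo n))

  nℚ-+ : ∀ m n → nℚ (m ℕ.+ n) ≡ nℚ m ℚ.+ nℚ n
  nℚ-+ m n rewrite nℚ≡mkℚ m | nℚ≡mkℚ n =
    ℚ./-cong {+ (m ℕ.+ n)} {1}
      (trans (ℤ.pos-+ m n) (sym (cong₂ ℤ._+_ (ℤ.*-identityʳ (+ m)) (ℤ.*-identityʳ (+ n))))) refl

  nℚ-* : ∀ m n → nℚ (m ℕ.* n) ≡ nℚ m ℚ.* nℚ n
  nℚ-* m n rewrite nℚ≡mkℚ m | nℚ≡mkℚ n = ℚ./-cong {+ (m ℕ.* n)} {1} (ℤ.pos-* m n) refl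

  negOnePow-parity : ∀ s → negOnePow s ≡ 1ℚ ℚ.- (+ 2 ℚ./ 1) ℚ.* nℚ (s % 2)
  negOnePow-parity zero          = refl
  negOnePow-parity (suc zero)    = refl
  negOnePow-parity (suc (suc s)) = begin
    ℚ.- ℚ.- negOnePow s                          ≡⟨ ⁻¹-involutive (negOnePow s) ⟩
    negOnePow s                                  ≡⟨ negOnePow-parity s ⟩
    1ℚ ℚ.- (+ 2 ℚ./ 1) ℚ.* nℚ (s % 2)
      ≡⟨ cong (λ r → 1ℚ ℚ.- (+ 2 ℚ./ 1) ℚ.* nℚ r) (trans (cong (_% 2) (ℕ.+-comm 2 s)) ([m+n]%n≡m%n s 2)) ⟨
    1ℚ ℚ.- (+ 2 ℚ./ 1) ℚ.* nℚ (suc (suc s) % 2)  ∎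
    where open ≡-Reasoning

  module _ where
    open +-*-Solver

    private
      two three four eight twenty/3 eight/3 : ℚ
      two = + 2 ℚ./ 1
      three = + 3 ℚ./ 1
      four = + 4 ℚ./ 1
      eight = + 8 ℚ./ 1
      twenty/3 = + 20 ℚ./ 3
      eight/3 = + 8 ℚ./ 3

    magicCount-ℚ : ∀ s → nℚ (magicCount (3 ℕ.* s)) ≡
                   two ℚ.* (nℚ s ℚ.* nℚ s) ℚ.- (two ℚ.* nℚ s ℚ.+ four ℚ.* nℚ (s / 2) ℚ.+ eight ℚ.* nℚ (s / 3))
    magicCount-ℚ s = begin
      M                      ≡⟨ add-sub M B ⟩
      M ℚ.+ B ℚ.- B          ≡⟨ cong (λ b → M ℚ.+ b ℚ.- B) nℚB ⟨
      M ℚ.+ nℚ b ℚ.- B       ≡⟨ cong (ℚ._- B) (nℚ-+ (magicCount (3 ℕ.* s)) b) ⟨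
      nℚ (magicCount (3 ℕ.* s) ℕ.+ b) ℚ.- B  ≡⟨ cong (λ n → nℚ n ℚ.- B) (magicCount-closed s) ⟩
      nℚ (2 ℕ.* (s ℕ.* s)) ℚ.- B             ≡⟨ cong (ℚ._- B) (trans (nℚ-* 2 (s ℕ.* s)) (cong (two ℚ.*_) (nℚ-* s s))) ⟩
      two ℚ.* (nℚ s ℚ.* nℚ s) ℚ.- B          ∎
      where
      open ≡-Reasoning
      M = nℚ (magicCount (3 ℕ.* s))
      b = 2 ℕ.* s ℕ.+ 4 ℕ.* (s / 2) ℕ.+ 8 ℕ.* (s / 3)
      B = two ℚ.* nℚ s ℚ.+ four ℚ.* nℚ (s / 2) ℚ.+ eight ℚ.* nℚ (s / 3)
      nℚB : nℚ b ≡ B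
      nℚB = trans (nℚ-+ (2 ℕ.* s ℕ.+ 4 ℕ.* (s / 2)) (8 ℕ.* (s / 3)))
                  (cong₂ ℚ._+_ (trans (nℚ-+ (2 ℕ.* s) (4 ℕ.* (s / 2))) (cong₂ ℚ._+_ (nℚ-* 2 s) (nℚ-* 4 (s / 2))))
                               (nℚ-* 8 (s / 3)))
      add-sub : ∀ M B → M ≡ M ℚ.+ B ℚ.- B
      add-sub = solve 2 (λ M B → M := M :+ B :- B) refl

    eliminate-floors : ∀ {S h p t ρ} → S ≡ p ℚ.+ h ℚ.* two → S ≡ ρ ℚ.+ t ℚ.* three →
      two ℚ.* (S ℚ.* S) ℚ.- (two ℚ.* S ℚ.+ four ℚ.* h ℚ.+ eight ℚ.* t) ≡
      two ℚ.* S ℚ.* S ℚ.- twenty/3 ℚ.* S ℚ.+ two ℚ.* p ℚ.+ eight/3 ℚ.* ρ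
    eliminate-floors {S} {h} {p} {t} {ρ} by-2 by-3 = begin
      two ℚ.* (S ℚ.* S) ℚ.- (two ℚ.* S ℚ.+ four ℚ.* h ℚ.+ eight ℚ.* t)
        ≡⟨ split S h p t ρ ⟩
      X ℚ.+ two ℚ.* (S ℚ.- (p ℚ.+ h ℚ.* two)) ℚ.+ eight/3 ℚ.* (S ℚ.- (ρ ℚ.+ t ℚ.* three))
        ≡⟨ cong₂ (λ u v → X ℚ.+ two ℚ.* (S ℚ.- u) ℚ.+ eight/3 ℚ.* (S ℚ.- v)) (sym by-2) (sym by-3) ⟩
      X ℚ.+ two ℚ.* (S ℚ.- S) ℚ.+ eight/3 ℚ.* (S ℚ.- S)
        ≡⟨ cancel X S ⟩
      X ∎
      where
      open ≡-Reasoning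
      X = two ℚ.* S ℚ.* S ℚ.- twenty/3 ℚ.* S ℚ.+ two ℚ.* p ℚ.+ eight/3 ℚ.* ρ
      split : ∀ S h p t ρ →
        two ℚ.* (S ℚ.* S) ℚ.- (two ℚ.* S ℚ.+ four ℚ.* h ℚ.+ eight ℚ.* t)
        ≡ (two ℚ.* S ℚ.* S ℚ.- twenty/3 ℚ.* S ℚ.+ two ℚ.* p ℚ.+ eight/3 ℚ.* ρ)
          ℚ.+ two ℚ.* (S ℚ.- (p ℚ.+ h ℚ.* two)) ℚ.+ eight/3 ℚ.* (S ℚ.- (ρ ℚ.+ t ℚ.* three))
      split = solve 5 (λ S h p t ρ →
        con two :* (S :* S) :- (con two :* S :+ con four :* h :+ con eight :* t)
        := (con two :* S :* S :- con twenty/3 :* S :+ con two :* p :+ con eight/3 :* ρ)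
           :+ con two :* (S :- (p :+ h :* con two)) :+ con eight/3 :* (S :- (ρ :+ t :* con three))) refl
      cancel : ∀ X S → X ℚ.+ two ℚ.* (S ℚ.- S) ℚ.+ eight/3 ℚ.* (S ℚ.- S) ≡ X
      cancel = solve 2 (λ X S → X :+ con two :* (S :- S) :+ con eight/3 :* (S :- S) := X) refl

    formula-closed : ∀ s → nℚ (magicCount (3 ℕ.* s)) ≡ formula s
    formula-closed s = begin
      nℚ (magicCount (3 ℕ.* s))
        ≡⟨ magicCount-ℚ s ⟩
      two ℚ.* (S ℚ.* S) ℚ.- (two ℚ.* S ℚ.+ four ℚ.* nℚ (s / 2) ℚ.+ eight ℚ.* nℚ (s / 3))
        ≡⟨ eliminate-floors {S} {nℚ (s / 2)} {p} {nℚ (s / 3)} {ρ} (by-quotient 2) (by-quotient 3) ⟩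
      two ℚ.* S ℚ.* S ℚ.- twenty/3 ℚ.* S ℚ.+ two ℚ.* p ℚ.+ eight/3 ℚ.* ρ
        ≡⟨ rearrange S p ρ ⟩
      (((two ℚ.* S ℚ.* S) ℚ.- (twenty/3 ℚ.* S)) ℚ.+ 1ℚ) ℚ.- (1ℚ ℚ.- two ℚ.* p) ℚ.+ (eight/3 ℚ.* ρ)
        ≡⟨ cong (λ u → (((two ℚ.* S ℚ.* S) ℚ.- (twenty/3 ℚ.* S)) ℚ.+ 1ℚ) ℚ.- u ℚ.+ (eight/3 ℚ.* ρ))
                (negOnePow-parity s) ⟨
      formula s ∎
      where
      open ≡-Reasoning
      S = nℚ s
      p = nℚ (s % 2)
      ρ = nℚ (s % 3)
      by-quotient : ∀ d .{{_ : ℕ.NonZero d}} → S ≡ nℚ (s % d) ℚ.+ nℚ (s / d) ℚ.* nℚ d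
      by-quotient d = trans (cong nℚ (m≡m%n+[m/n]*n s d))
                            (trans (nℚ-+ (s % d) (s / d ℕ.* d)) (cong (nℚ (s % d) ℚ.+_) (nℚ-* (s / d) d)))
      rearrange : ∀ S p ρ → two ℚ.* S ℚ.* S ℚ.- twenty/3 ℚ.* S ℚ.+ two ℚ.* p ℚ.+ eight/3 ℚ.* ρ
                  ≡ (((two ℚ.* S ℚ.* S) ℚ.- (twenty/3 ℚ.* S)) ℚ.+ 1ℚ) ℚ.- (1ℚ ℚ.- two ℚ.* p) ℚ.+ (eight/3 ℚ.* ρ)
      rearrange = solve 3 (λ S p ρ →
        con two :* S :* S :- con twenty/3 :* S :+ con two :* p :+ con eight/3 :* ρ
        := (((con two :* S :* S) :- (con twenty/3 :* S)) :+ con 1ℚ) :- (con 1ℚ :- con two :* p) :+ (con eight/3 :* ρ)) refl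

module GeneratingFunction where

  open import Data.Nat as ℕ using (ℕ; zero; suc; z≤n; s≤s)
  import Data.Nat.Properties as ℕ
  open import Data.Nat.DivMod using (_/_; +-distrib-/-∣ˡ; m*n/n≡m)
  open import Data.Nat.Divisibility using (divides-refl)
  open import Data.Integer using (ℤ; +_; 0ℤ; _+_; _-_; _*_; -_)
  import Data.Integer.Properties as ℤ
  import Data.Integer.Tactic.RingSolver as ℤ-Solver
  open import Data.List using ([]; _∷_; length)
  open import Data.Sum using (inj₁; inj₂)
  open import Relation.Binary.PropositionalEquality
  open import Defs
  open Totals

  closedForm : ℤ → ℤ → ℤ → ℤ
  closedForm N H T = + 2 * N * N - + 2 * N - + 4 * H - + 8 * T

  closed : ℕ → ℤ
  closed n = closedForm (+ n) (+ (n / 2)) (+ (n / 3))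

  magicGF≡closed : ∀ n → magicGF n ≡ closed n
  magicGF≡closed n = begin
    + M                                          ≡⟨ isolate (+ M) (+ B) ⟩
    (+ M + + B) - + B                            ≡⟨ cong (_- + B) (trans (sym (ℤ.pos-+ M B)) (cong +_ (magicCount-closed n))) ⟩
    + (2 ℕ.* (n ℕ.* n)) - + B                    ≡⟨ cong₂ _-_ (trans (ℤ.pos-* 2 (n ℕ.* n)) (cong (+ 2 *_) (ℤ.pos-* n n))) B≡ ⟩
    + 2 * (+ n * + n) - (+ 2 * + n + + 4 * + (n / 2) + + 8 * + (n / 3)) ≡⟨ expand (+ n) (+ (n / 2)) (+ (n / 3)) ⟩
    closed n                                     ∎
    where
    open ≡-Reasoning
    M = magicCount (3 ℕ.* n)
    B = 2 ℕ.* n ℕ.+ 4 ℕ.* (n / 2) ℕ.+ 8 ℕ.* (n / 3)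
    B≡ : + B ≡ + 2 * + n + + 4 * + (n / 2) + + 8 * + (n / 3)
    B≡ = trans (ℤ.pos-+ (2 ℕ.* n ℕ.+ 4 ℕ.* (n / 2)) (8 ℕ.* (n / 3)))
               (cong₂ _+_ (trans (ℤ.pos-+ (2 ℕ.* n) (4 ℕ.* (n / 2))) (cong₂ _+_ (ℤ.pos-* 2 n) (ℤ.pos-* 4 (n / 2))))
                          (ℤ.pos-* 8 (n / 3)))
    isolate : ∀ a b → a ≡ (a + b) - b
    isolate = ℤ-Solver.solve-∀
    expand : ∀ N H T → + 2 * (N * N) - (+ 2 * N + + 4 * H + + 8 * T) ≡ + 2 * N * N - + 2 * N - + 4 * H - + 8 * T
    expand = ℤ-Solver.solve-∀

  sumTo-cong : ∀ {F G : ℕ → ℤ} n → (∀ k → F k ≡ G k) → sumTo F n ≡ sumTo G n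
  sumTo-cong zero    F≗G = F≗G zero
  sumTo-cong (suc n) F≗G = cong₂ _+_ (sumTo-cong n F≗G) (F≗G (suc n))

  sumTo-zero : ∀ {F : ℕ → ℤ} n → (∀ k → k ℕ.≤ n → F k ≡ 0ℤ) → sumTo F n ≡ 0ℤ
  sumTo-zero zero    F≡0 = F≡0 zero z≤n
  sumTo-zero (suc n) F≡0 = cong₂ _+_ (sumTo-zero n (λ k k≤n → F≡0 k (ℕ.m≤n⇒m≤1+n k≤n))) (F≡0 (suc n) ℕ.≤-refl)

  sumTo-beyond : ∀ {F : ℕ → ℤ} n → (∀ j → F (suc n ℕ.+ j) ≡ 0ℤ) → ∀ m → sumTo F (n ℕ.+ m) ≡ sumTo F n
  sumTo-beyond n F≡0 zero    = cong (sumTo _) (ℕ.+-identityʳ n)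
  sumTo-beyond {F} n F≡0 (suc m) rewrite ℕ.+-suc n m | F≡0 m = trans (ℤ.+-identityʳ _) (sumTo-beyond n F≡0 m)

  poly-vanishes : ∀ cs k → length cs ℕ.≤ k → poly cs k ≡ 0ℤ
  poly-vanishes []       k       _         = refl
  poly-vanishes (c ∷ cs) (suc k) (s≤s len≤k) = poly-vanishes cs k len≤k

  ⊛-vanishes : ∀ f g df dg → (∀ k → df ℕ.< k → f k ≡ 0ℤ) → (∀ k → dg ℕ.< k → g k ≡ 0ℤ) →
               ∀ k → df ℕ.+ dg ℕ.< k → (f ⊛ g) k ≡ 0ℤ
  ⊛-vanishes f g df dg f≡0 g≡0 k df+dg<k = sumTo-zero k term≡0
    where
    term≡0 : ∀ j → j ℕ.≤ k → f j * g (k ℕ.∸ j) ≡ 0ℤ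
    term≡0 j j≤k with ℕ.≤-<-connex j df
    ... | inj₁ j≤df = trans (cong (f j *_) (g≡0 (k ℕ.∸ j) dg<k∸j)) (ℤ.*-zeroʳ (f j))
      where
      dg<k∸j : dg ℕ.< k ℕ.∸ j
      dg<k∸j = ℕ.+-cancelˡ-< j dg (k ℕ.∸ j) (ℕ.≤-<-trans (ℕ.+-monoˡ-≤ dg j≤df)
                 (ℕ.<-≤-trans df+dg<k (ℕ.≤-reflexive (sym (ℕ.m+[n∸m]≡n j≤k)))))
    ... | inj₂ df<j = cong (_* g (k ℕ.∸ j)) (f≡0 j df<j)

  denominator-vanishes : ∀ k → 6 ℕ.< k → denominator k ≡ 0ℤ
  denominator-vanishes = ⊛-vanishes _ _ 3 3
    (⊛-vanishes _ _ 1 2 (λ k → poly-vanishes (+ 1 ∷ - + 1 ∷ []) k) (λ k → poly-vanishes (+ 1 ∷ + 0 ∷ - + 1 ∷ []) k))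
    (λ k → poly-vanishes (+ 1 ∷ + 0 ∷ + 0 ∷ - + 1 ∷ []) k)

  [qd+n]/d≡q+n/d : ∀ q d n .{{_ : ℕ.NonZero d}} → (q ℕ.* d ℕ.+ n) / d ≡ q ℕ.+ n / d
  [qd+n]/d≡q+n/d q d n = trans (+-distrib-/-∣ˡ n (divides-refl q)) (cong (ℕ._+ n / d) (m*n/n≡m q d))

  closed-shift : ∀ k m a h b t → (k ℕ.+ m) / 2 ≡ a ℕ.+ h → (k ℕ.+ m) / 3 ≡ b ℕ.+ t →
                 closed (k ℕ.+ m) ≡ closedForm (+ k + + m) (+ a + + h) (+ b + + t)
  closed-shift k m a h b t eq₂ eq₃ rewrite eq₂ | eq₃ | ℤ.pos-+ k m | ℤ.pos-+ a h | ℤ.pos-+ b t = refl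

  recurrence-identity : ∀ M H₀ H₁ T₀ T₁ T₂ →
      + 1 * (+ 2 * (+ 7 + M) * (+ 7 + M) - + 2 * (+ 7 + M) - + 4 * (+ 3 + H₁) - + 8 * (+ 2 + T₁))
    + - + 1 * (+ 2 * (+ 6 + M) * (+ 6 + M) - + 2 * (+ 6 + M) - + 4 * (+ 3 + H₀) - + 8 * (+ 2 + T₀))
    + - + 1 * (+ 2 * (+ 5 + M) * (+ 5 + M) - + 2 * (+ 5 + M) - + 4 * (+ 2 + H₁) - + 8 * (+ 1 + T₂))
    + + 0 * (+ 2 * (+ 4 + M) * (+ 4 + M) - + 2 * (+ 4 + M) - + 4 * (+ 2 + H₀) - + 8 * (+ 1 + T₁))
    + + 1 * (+ 2 * (+ 3 + M) * (+ 3 + M) - + 2 * (+ 3 + M) - + 4 * (+ 1 + H₁) - + 8 * (+ 1 + T₀))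
    + + 1 * (+ 2 * (+ 2 + M) * (+ 2 + M) - + 2 * (+ 2 + M) - + 4 * (+ 1 + H₀) - + 8 * (+ 0 + T₂))
    + - + 1 * (+ 2 * (+ 1 + M) * (+ 1 + M) - + 2 * (+ 1 + M) - + 4 * (+ 0 + H₁) - + 8 * (+ 0 + T₁))
    ≡ 0ℤ
  recurrence-identity = ℤ-Solver.solve-∀

  -- The coefficients 1, −1, −1, 0, 1, 1, −1 are those of (1 − t)(1 − t²)(1 − t³); expressing the floors of
  -- (k + m)/2 and (k + m)/3 through those of m, m + 1, m + 2 turns the claim into recurrence-identity.
  recurrence : ∀ m → sumTo (λ k → denominator k * closed (7 ℕ.+ m ℕ.∸ k)) 6 ≡ 0ℤ
  recurrence m = trans
    (combine-cong (closed-shift 7 m 3 h₁ 2 t₁ (q+ 3 2 (1 ℕ.+ m)) (q+ 2 3 (1 ℕ.+ m)))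
                  (closed-shift 6 m 3 h₀ 2 t₀ (q+ 3 2 m) (q+ 2 3 m))
                  (closed-shift 5 m 2 h₁ 1 t₂ (q+ 2 2 (1 ℕ.+ m)) (q+ 1 3 (2 ℕ.+ m)))
                  (closed-shift 4 m 2 h₀ 1 t₁ (q+ 2 2 m) (q+ 1 3 (1 ℕ.+ m)))
                  (closed-shift 3 m 1 h₁ 1 t₀ (q+ 1 2 (1 ℕ.+ m)) (q+ 1 3 m))
                  (closed-shift 2 m 1 h₀ 0 t₂ (q+ 1 2 m) (q+ 0 3 (2 ℕ.+ m)))
                  (closed-shift 1 m 0 h₁ 0 t₁ (q+ 0 2 (1 ℕ.+ m)) (q+ 0 3 (1 ℕ.+ m))))
    (recurrence-identity (+ m) (+ h₀) (+ h₁) (+ t₀) (+ t₁) (+ t₂))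
    where
    q+ = [qd+n]/d≡q+n/d
    h₀ = m / 2
    h₁ = (1 ℕ.+ m) / 2
    t₀ = m / 3
    t₁ = (1 ℕ.+ m) / 3
    t₂ = (2 ℕ.+ m) / 3
    combine : ℤ → ℤ → ℤ → ℤ → ℤ → ℤ → ℤ → ℤ
    combine c₇ c₆ c₅ c₄ c₃ c₂ c₁ = + 1 * c₇ + - + 1 * c₆ + - + 1 * c₅ + + 0 * c₄ + + 1 * c₃ + + 1 * c₂ + - + 1 * c₁
    combine-cong : ∀ {c₇ c₆ c₅ c₄ c₃ c₂ c₁ d₇ d₆ d₅ d₄ d₃ d₂ d₁} →
      c₇ ≡ d₇ → c₆ ≡ d₆ → c₅ ≡ d₅ → c₄ ≡ d₄ → c₃ ≡ d₃ → c₂ ≡ d₂ → c₁ ≡ d₁ →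
      combine c₇ c₆ c₅ c₄ c₃ c₂ c₁ ≡ combine d₇ d₆ d₅ d₄ d₃ d₂ d₁
    combine-cong refl refl refl refl refl refl refl = refl

  denominator⊛closed : ∀ n → (denominator ⊛ closed) n ≡ numerator n
  denominator⊛closed 0 = refl
  denominator⊛closed 1 = refl
  denominator⊛closed 2 = refl
  denominator⊛closed 3 = refl
  denominator⊛closed 4 = refl
  denominator⊛closed 5 = refl
  denominator⊛closed 6 = refl
  denominator⊛closed (suc (suc (suc (suc (suc (suc (suc m))))))) =
    trans (sumTo-beyond 6 (λ j → cong (_* closed (7 ℕ.+ m ℕ.∸ (7 ℕ.+ j)))
                                      (denominator-vanishes (7 ℕ.+ j) (s≤s (ℕ.m≤m+n 6 j)))) (suc m))
          (recurrence m)

  denominator⊛magicGF : ∀ n → (denominator ⊛ magicGF) n ≡ numerator n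
  denominator⊛magicGF n =
    trans (sumTo-cong n (λ k → cong (denominator k *_) (magicGF≡closed (n ℕ.∸ k)))) (denominator⊛closed n)

open import Data.Nat using (ℕ; _*_; _∸_; _+_)
open import Data.Nat.DivMod using (_/_)
open import Data.Nat.Properties using (m+n∸n≡m)
open import Data.List using ([]; _∷_; map; upTo)
open import Data.List.Properties using (map-cong)
open import Data.Product using (_×_; _,_)
open import Relation.Binary.PropositionalEquality
open import Defs
open Totals
open ClosedFormula
open GeneratingFunction

magicCount≡ : ∀ s → magicCount (3 * s) ≡ 2 * (s * s) ∸ (2 * s + 4 * (s / 2) + 8 * (s / 3))
magicCount≡ s = trans (sym (m+n∸n≡m (magicCount (3 * s)) B)) (cong (_∸ B) (magicCount-closed s))
  where
  B = 2 * s + 4 * (s / 2) + 8 * (s / 3)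

corollary2p3 : (∀ (s : ℕ) → nℚ (magicCount (3 * s)) ≡ formula s)
    × (∀ (n : ℕ) → (denominator ⊛ magicGF) n ≡ numerator n)
    × (map (λ s → magicCount (3 * s)) (upTo 13)
        ≡ map (8 *_) (0 ∷ 0 ∷ 0 ∷ 0 ∷ 1 ∷ 3 ∷ 4 ∷ 7 ∷ 10 ∷ 13 ∷ 17 ∷ 22 ∷ 26 ∷ []))
corollary2p3 = formula-closed , denominator⊛magicGF , trans (map-cong magicCount≡ (upTo 13)) refl
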